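{- (1) For $n\ge1$, the primary theta-seed $\Delta_1(\bm\theta_n)=\sum_{\sigma\in\mathfrak{S}_n}\mathrm{sgn}(\sigma)\sigma(\theta_1\theta_2\cdots\theta_{n-1})$ lies in $T_n$. (2) For $n\ge3$, the secondary theta-seed $\Delta_2(\bm\theta_n)=\sum_{\sigma\in\mathfrak{S}_n}\mathrm{sgn}(\sigma)\sigma\big((\theta_1\xi_2\rho_2+\theta_2\xi_1\rho_2+\theta_2\xi_2\rho_1)\theta_3\theta_4\cdots\theta_{n-1}\big)$ lies in $T_n$. (Empty products of $\theta$'s, for $n=1$ resp. $n=3$, are $1$.)
   Context: $\mathbb{Q}[\bm\theta_n,\bm\xi_n,\bm\rho_n]$ is the exterior algebra over $\mathbb{Q}$ on the $3n$ pairwise anticommuting generators $\theta_i,\xi_i,\rho_i$, with $\mathfrak{S}_n$ acting diagonally by $\sigma(\theta_i)=\theta_{\sigma(i)}$, $\sigma(\xi_i)=\xi_{\sigma(i)}$, $\sigma(\rho_i)=\rho_{\sigma(i)}$. Derivatives: $\partial_{\theta_j}\theta_{i_1}\cdots\theta_{i_k}=(-1)^{\ell-1}\theta_{i_1}\cdots\widehat{\theta_{i_\ell}}\cdots\theta_{i_k}$ if $\theta_j$ is the $\ell$-th factor, else $0$ (for generators of any of the three sets). The space of triagonal fermionic harmonics is $T_n=\{f:\sum_{i=1}^n\partial_{\theta_i}^h\partial_{\xi_i}^k\partial_{\rho_i}^\ell f=0\ \text{for all } h,k,\ell\in\{0,1\}\text{ with } h+k+\ell>0\}$. -}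

module Defs where

open import Data.Bool using (Bool; true; false; if_then_else_; _∧_; _∨_; not)
open import Data.Nat using (ℕ; zero; suc; _+_; _*_; _<ᵇ_; _≡ᵇ_)
open import Data.Fin using (Fin; toℕ; inject₁) renaming (zero to fz; suc to fs)
open import Data.Fin.Base using () renaming (zero to fzero)
open import Data.List using (List; []; _∷_; _++_; map; concatMap; filter; length; foldr; allFin)
open import Data.Vec using (Vec; lookup; toList) renaming ([] to []ᵥ; _∷_ to _∷ᵥ_)
open import Data.Maybe using (Maybe; just; nothing)
open import Data.Product using (_×_; _,_; proj₁; proj₂)
open import Data.Rational using (ℚ; 0ℚ; 1ℚ; -_) renaming (_+_ to _+ℚ_; _*_ to _*ℚ_)
open import Data.List.Properties using () renaming (≡-dec to listDec)
open import Data.Nat.Properties using () renaming (_≟_ to _≟ℕ_)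
open import Relation.Nullary using (does)
open import Relation.Binary.PropositionalEquality using (_≡_)

-- Generators of Q[θ_n, ξ_n, ρ_n]: a kind (0 = θ, 1 = ξ, 2 = ρ) and an
-- index in Fin n (Fin index j stands for the paper's index j+1).

Gen : ℕ → Set
Gen n = Fin 3 × Fin n

θ ξ ρ : ∀ {n} → Fin n → Gen n
θ i = (fz , i)
ξ i = (fs fz , i)
ρ i = (fs (fs fz) , i)

code : ∀ {n} → Gen n → ℕ
code (k , i) = toℕ i * 3 + toℕ k

_==_ : ∀ {n} → Gen n → Gen n → Bool
g == h = code g ≡ᵇ code h

Word : ℕ → Set
Word n = List (Gen n)

-- An element of the exterior algebra is presented as a formal
-- Q-linear combination of words; it denotes the corresponding element
-- of the exterior algebra (generators pairwise anticommuting, squares 0).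
Elt : ℕ → Set
Elt n = List (ℚ × Word n)

-- Normal form: every word equals ±(strictly increasing word) or 0.

consNeg : ∀ {n} → Maybe (ℚ × Word n) → Gen n → Maybe (ℚ × Word n)
consNeg nothing h = nothing
consNeg (just (s , l)) h = just (- s , h ∷ l)

insertSorted : ∀ {n} → Gen n → Word n → Maybe (ℚ × Word n)
insertSorted g [] = just (1ℚ , g ∷ [])
insertSorted g (h ∷ t) =
  if code g <ᵇ code h then just (1ℚ , g ∷ h ∷ t)
  else (if code g ≡ᵇ code h then nothing
  else consNeg (insertSorted g t) h)

normWord : ∀ {n} → Word n → Maybe (ℚ × Word n)
normWord [] = just (1ℚ , [])
normWord (g ∷ w) with normWord w
... | nothing = nothing
... | just (s , l) with insertSorted g l
...   | nothing = nothing
...   | just (s' , l') = just (s *ℚ s' , l')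

-- expand an element in the standard monomial basis (with repetitions
-- of basis monomials allowed)
scaleM : ∀ {n} → ℚ → Maybe (ℚ × Word n) → Elt n
scaleM c nothing = []
scaleM c (just (s , l)) = (c *ℚ s , l) ∷ []

normTerm : ∀ {n} → ℚ × Word n → Elt n
normTerm (c , w) = scaleM c (normWord w)

normalize : ∀ {n} → Elt n → Elt n
normalize = concatMap normTerm

-- coefficient of the basis monomial m (any word m; zero unless m is
-- strictly increasing)
coeff : ∀ {n} → Elt n → Word n → ℚ
coeff {n} f m = foldr _+ℚ_ 0ℚ (map proj₁ (filter (λ t → listDec _≟ℕ_ (map code (proj₂ t)) (map code m)) (normalize f)))

IsZero : ∀ {n} → Elt n → Set
IsZero f = ∀ m → coeff f m ≡ 0ℚ

-- Derivatives, on monomials θ_{i1}...θ_{ik} (no repeated factors):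
-- ∂_g removes the factor g, which sits in position ℓ, with sign (-1)^(ℓ-1);
-- 0 if g is not a factor.  Extended linearly.

derivWord : ∀ {n} → Gen n → Word n → Maybe (ℚ × Word n)
derivWord g [] = nothing
derivWord g (h ∷ t) = if g == h then just (1ℚ , t) else consNeg (derivWord g t) h

derivTerm : ∀ {n} → Gen n → ℚ × Word n → Elt n
derivTerm g (c , w) = scaleM c (derivWord g w)

∂ : ∀ {n} → Gen n → Elt n → Elt n
∂ g f = concatMap (derivTerm g) (normalize f)

-- The symmetric group S_n, enumerated as the list of bijections
-- Fin n → Fin n (given by their value tables), with sign (-1)^{#inversions}.

allTables : (n m : ℕ) → List (Vec (Fin n) m)
allTables n zero = []ᵥ ∷ []
allTables n (suc m) = concatMap (λ i → map (i ∷ᵥ_) (allTables n m)) (allFin n)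

private
  elem : ∀ {n} → Fin n → List (Fin n) → Bool
  elem i [] = false
  elem i (j ∷ js) = (toℕ i ≡ᵇ toℕ j) ∨ elem i js

  nodup : ∀ {n} → List (Fin n) → Bool
  nodup [] = true
  nodup (i ∷ is) = not (elem i is) ∧ nodup is

Perm : ℕ → Set
Perm n = Vec (Fin n) n

symGroup : (n : ℕ) → List (Perm n)
symGroup n = filter (λ σ → Relation.Nullary.Decidable.Core.T? (nodup (toList σ))) (allTables n n)
  where import Relation.Nullary.Decidable.Core

inversions : ∀ {n} → List (Fin n) → ℕ
inversions [] = 0
inversions (x ∷ xs) = length (filter (λ y → Data.Nat._<?_ (toℕ y) (toℕ x)) xs) + inversions xs
  where import Data.Nat

sgn : ∀ {n} → Perm n → ℚ
sgn σ = pow (inversions (toList σ))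
  where
  pow : ℕ → ℚ
  pow zero = 1ℚ
  pow (suc k) = - pow k

actGen : ∀ {n} → Perm n → Gen n → Gen n
actGen σ (k , i) = (k , lookup σ i)

act : ∀ {n} → Perm n → Elt n → Elt n
act σ = map (λ t → (proj₁ t , map (actGen σ) (proj₂ t)))

antisym : ∀ {n} → Elt n → Elt n
antisym {n} f = concatMap (λ σ → map (λ t → (sgn σ *ℚ proj₁ t , proj₂ t)) (act σ f)) (symGroup n)

D : ∀ {n} → Bool → Gen n → Elt n → Elt n
D b g f = if b then ∂ g f else f

polarized : ∀ {n} → Bool → Bool → Bool → Elt n → Elt n
polarized {n} h k l f = concatMap (λ i → D h (θ i) (D k (ξ i) (D l (ρ i) f))) (allFin n)

InT : (n : ℕ) → Elt n → Set
InT n f = ∀ (h k l : Bool) → Data.Bool.T (h ∨ k ∨ l) → IsZero (polarized h k l f)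
  where import Data.Bool

-- Theta-seeds.  Δ1 is for n = suc m: θ_1 ⋯ θ_{n-1} (Fin indices 0..m-1).

Δ₁ : (m : ℕ) → Elt (suc m)
Δ₁ m = antisym ((1ℚ , map (λ i → θ (inject₁ i)) (allFin m)) ∷ [])

-- Δ2 is for n = 3 + m; θ_3 ⋯ θ_{n-1} are Fin indices 2..m+1.
Δ₂ : (m : ℕ) → Elt (3 + m)
Δ₂ m = antisym ( (1ℚ , θ i1 ∷ ξ i2 ∷ ρ i2 ∷ tl)
               ∷ (1ℚ , θ i2 ∷ ξ i1 ∷ ρ i2 ∷ tl)
               ∷ (1ℚ , θ i2 ∷ ξ i2 ∷ ρ i1 ∷ tl) ∷ [])
  where
  i1 i2 : Fin (3 + m)
  i1 = fz
  i2 = fs fz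
  tl : Word (3 + m)
  tl = map (λ j → θ (fs (fs (inject₁ j)))) (allFin m)

-- A coefficient of an element of the exterior algebra is its pairing ⟨ f ∣ m ⟩ with an
-- increasing word m, where ⟨ w ∣ m ⟩ is the constant term of ∂_{w_k} ⋯ ∂_{w_1} m; under this
-- pairing ∂_g is adjoint to left multiplication by g. Pairing a polarized derivative
-- Σ_i ∂^h_{θ_i} ∂^k_{ξ_i} ∂^l_{ρ_i} of Σ_σ sgn(σ) σ(F) with m and substituting i = σ(j)
-- leaves Σ_j the pairings of m with the antisymmetrisations of ∂^h_{θ_j} ∂^k_{ξ_j} ∂^l_{ρ_j} F.
-- The antisymmetrisation of a word missing two indices is zero, because the transposition
-- of these indices fixes the word and changes the sign. A derivative of θ_1 ⋯ θ_{n-1} at an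
-- index j misses both j and n. The same holds for the seed Δ₂ at every index j ≥ 3; at the
-- indices 1 and 2 the surviving words either miss two indices or cancel in pairs under the
-- transposition (1 2).

module Submission where

open import Defs
open import Data.Bool using (Bool; true; false; if_then_else_; _∧_; _∨_; not; T)
open import Data.Bool.ListAction using (any)
open import Data.Bool.Properties as BP using ()
open import Data.Empty using (⊥-elim)
open import Data.Fin as F using (Fin; toℕ; inject₁) renaming (zero to fz; suc to fs)
open import Data.Fin.Properties as FP using ()
open import Data.List using (List; []; _∷_; _++_; map; concatMap; filter; length; foldr; allFin)
open import Data.List.Membership.Propositional using (_∈_)
open import Data.List.Properties as LP using () renaming (≡-dec to listDec)
open import Data.List.Relation.Unary.All as All using (All; []; _∷_)
open import Data.List.Relation.Unary.All.Properties as AllP using ()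
open import Data.List.Relation.Unary.AllPairs as AllPairs using (AllPairs; []; _∷_)
open import Data.List.Relation.Unary.Any as Any using (here; there)
open import Data.List.Relation.Unary.Unique.DecPropositional using (unique?)
open import Data.List.Relation.Unary.Unique.Propositional using (Unique)
open import Data.List.Relation.Unary.Unique.Propositional.Properties as UP using ()
open import Data.Maybe as Maybe using (Maybe; just; nothing)
open import Data.Maybe.Relation.Unary.All as MAll using (just; nothing)
open import Data.Nat as ℕ using (ℕ; zero; suc; _<_; _≤_; s≤s; z≤n)
open import Data.Nat.Properties as ℕP using ()
open import Data.Product as Product using (Σ; _×_; _,_; proj₁; proj₂)
open import Data.Rational as Q using (ℚ; 0ℚ; 1ℚ; -_; _+_; _*_)
open import Data.Rational.Properties as QP using ()
open import Data.Rational.Solver using (module +-*-Solver)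
open import Data.Sum using (_⊎_; inj₁; inj₂; [_,_])
open import Data.Vec using (Vec; toList; lookup) renaming ([] to []ᵥ; _∷_ to _∷ᵥ_)
open import Data.Vec.Properties as VP using ()
open import Data.Vec.Relation.Unary.All.Properties as VAllP using ()
open import Data.Vec.Relation.Unary.AllPairs using ([]; _∷_)
open import Data.Vec.Relation.Unary.Unique.Propositional as VU using ()
open import Data.Vec.Relation.Unary.Unique.Propositional.Properties as VUP using ()
open import Function using (_∘_; Equivalence)
open import Function.Definitions using (Injective)
open import Relation.Binary.Definitions using (DecidableEquality; tri<; tri≈; tri>)
open import Relation.Binary.PropositionalEquality hiding ([_])
open import Relation.Nullary using (Dec; yes; no; ¬_; does)
open import Relation.Nullary.Decidable using (map′; dec-true; dec-false; True; toWitness; ¬?)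
open import Relation.Unary using (Decidable)
open +-*-Solver
open import Algebra.Properties.CommutativeSemigroup ℕP.+-commutativeSemigroup using () renaming (x∙yz≈y∙xz to +-exchange)
open import Algebra.Properties.Group QP.+-0-group using (⁻¹-involutive)

x≡-x⇒x≡0 : ∀ {q} → q ≡ - q → q ≡ 0ℚ
x≡-x⇒x≡0 {q} q≡-q = begin
  q
    ≡⟨ sym (QP.*-identityʳ q) ⟩
  q * (Q.½ + Q.½)
    ≡⟨ solve 2 (λ x h → x :* (h :+ h) := h :* (x :+ x)) refl q Q.½ ⟩
  Q.½ * (q + q)
    ≡⟨ cong (λ z → Q.½ * (q + z)) q≡-q ⟩
  Q.½ * (q + - q)
    ≡⟨ cong (Q.½ *_) (QP.+-inverseʳ q) ⟩
  Q.½ * 0ℚ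
    ≡⟨ QP.*-zeroʳ Q.½ ⟩
  0ℚ ∎
  where open ≡-Reasoning

∑ : {A : Set} → (A → ℚ) → List A → ℚ
∑ f [] = 0ℚ
∑ f (x ∷ xs) = f x + ∑ f xs

module _ {A : Set} where

  ∑-congᴬ : {f g : A → ℚ} {xs : List A} → All (λ x → f x ≡ g x) xs → ∑ f xs ≡ ∑ g xs
  ∑-congᴬ [] = refl
  ∑-congᴬ (e ∷ es) = cong₂ _+_ e (∑-congᴬ es)

  ∑-cong : {f g : A → ℚ} → (∀ x → f x ≡ g x) → ∀ xs → ∑ f xs ≡ ∑ g xs
  ∑-cong e xs = ∑-congᴬ (All.universal e xs)

  ∑-zeroᴬ : {f : A → ℚ} {xs : List A} → All (λ x → f x ≡ 0ℚ) xs → ∑ f xs ≡ 0ℚ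
  ∑-zeroᴬ [] = refl
  ∑-zeroᴬ (e ∷ es) = cong₂ _+_ e (∑-zeroᴬ es)

  ∑-zero : {f : A → ℚ} → (∀ x → f x ≡ 0ℚ) → ∀ xs → ∑ f xs ≡ 0ℚ
  ∑-zero e xs = ∑-zeroᴬ (All.universal e xs)

  ∑-++ : (f : A → ℚ) (xs ys : List A) → ∑ f (xs ++ ys) ≡ ∑ f xs + ∑ f ys
  ∑-++ f [] ys = sym (QP.+-identityˡ _)
  ∑-++ f (x ∷ xs) ys = trans (cong (f x +_) (∑-++ f xs ys)) (sym (QP.+-assoc (f x) _ _))

  ∑-+ : (f g : A → ℚ) (xs : List A) → ∑ (λ x → f x + g x) xs ≡ ∑ f xs + ∑ g xs
  ∑-+ f g [] = refl
  ∑-+ f g (x ∷ xs) = trans (cong (f x + g x +_) (∑-+ f g xs))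
    (solve 4 (λ a b c d → (a :+ b) :+ (c :+ d) := (a :+ c) :+ (b :+ d)) refl (f x) (g x) (∑ f xs) (∑ g xs))

  ∑-*ˡ : (c : ℚ) (f : A → ℚ) (xs : List A) → ∑ (λ x → c * f x) xs ≡ c * ∑ f xs
  ∑-*ˡ c f [] = sym (QP.*-zeroʳ c)
  ∑-*ˡ c f (x ∷ xs) = trans (cong (c * f x +_) (∑-*ˡ c f xs)) (sym (QP.*-distribˡ-+ c (f x) _))

  ∑-neg : (f : A → ℚ) (xs : List A) → ∑ (λ x → - f x) xs ≡ - ∑ f xs
  ∑-neg f [] = refl
  ∑-neg f (x ∷ xs) = trans (cong (- f x +_) (∑-neg f xs)) (sym (QP.neg-distrib-+ (f x) _))

  ∑-filter : {P : A → Set} (P? : Decidable P) (f : A → ℚ) (xs : List A) →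
    ∑ f (filter P? xs) ≡ ∑ (λ x → if does (P? x) then f x else 0ℚ) xs
  ∑-filter P? f [] = refl
  ∑-filter P? f (x ∷ xs) with does (P? x)
  ... | true = cong (f x +_) (∑-filter P? f xs)
  ... | false = trans (∑-filter P? f xs) (sym (QP.+-identityˡ _))

  foldr-+-map : (f : A → ℚ) (xs : List A) → foldr _+_ 0ℚ (map f xs) ≡ ∑ f xs
  foldr-+-map f [] = refl
  foldr-+-map f (x ∷ xs) = cong (f x +_) (foldr-+-map f xs)

module _ {A B : Set} where

  ∑-map : (f : B → ℚ) (g : A → B) (xs : List A) → ∑ f (map g xs) ≡ ∑ (f ∘ g) xs
  ∑-map f g [] = refl
  ∑-map f g (x ∷ xs) = cong (f (g x) +_) (∑-map f g xs)

  ∑-concatMap : (f : B → ℚ) (g : A → List B) (xs : List A) → ∑ f (concatMap g xs) ≡ ∑ (λ x → ∑ f (g x)) xs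
  ∑-concatMap f g [] = refl
  ∑-concatMap f g (x ∷ xs) = trans (∑-++ f (g x) (concatMap g xs)) (cong (∑ f (g x) +_) (∑-concatMap f g xs))

  ∑-comm : (f : A → B → ℚ) (xs : List A) (ys : List B) →
    ∑ (λ x → ∑ (f x) ys) xs ≡ ∑ (λ y → ∑ (λ x → f x y) xs) ys
  ∑-comm f [] ys = sym (∑-zero (λ _ → refl) ys)
  ∑-comm f (x ∷ xs) ys = trans (cong (∑ (f x) ys +_) (∑-comm f xs ys)) (sym (∑-+ (f x) _ ys))

concatMap-All : {A B : Set} {P : A → Set} {R : B → Set} (g : A → List B) → (∀ {x} → P x → All R (g x)) →
  {xs : List A} → All P xs → All R (concatMap g xs)
concatMap-All g h ps = AllP.concat⁺ (AllP.map⁺ (All.map h ps))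

All-map-allFin : ∀ {k} {B : Set} {R : B → Set} (g : Fin k → B) → (∀ i → R (g i)) → All R (map g (allFin k))
All-map-allFin g r = AllP.map⁺ (AllP.tabulate⁺ r)

module _ {n : ℕ} where

  code≡toℕ-combine : (g : Gen n) → code g ≡ toℕ (F.combine (proj₂ g) (proj₁ g))
  code≡toℕ-combine (k , i) = trans (cong (ℕ._+ toℕ k) (ℕP.*-comm (toℕ i) 3)) (sym (FP.toℕ-combine i k))

  code-injective : (g h : Gen n) → code g ≡ code h → g ≡ h
  code-injective (k , i) (k′ , i′) e
    with FP.combine-injective i k i′ k′ (FP.toℕ-injective (trans (sym (code≡toℕ-combine (k , i)))
                                                              (trans e (code≡toℕ-combine (k′ , i′)))))
  ... | refl , refl = refl

  -- `does (g ≟ᴳ h)` unfolds to `g == h`, the test made by derivWord.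
  _≟ᴳ_ : DecidableEquality (Gen n)
  g ≟ᴳ h = map′ (code-injective g h) (cong code) (code g ℕP.≟ code h)

  derivWord-here : (g : Gen n) (t : Word n) → derivWord g (g ∷ t) ≡ just (1ℚ , t)
  derivWord-here g t = cong (λ b → if b then just (1ℚ , t) else consNeg (derivWord g t) g) (dec-true (g ≟ᴳ g) refl)

  derivWord-there : {g h : Gen n} (t : Word n) → g ≢ h → derivWord g (h ∷ t) ≡ consNeg (derivWord g t) h
  derivWord-there {g} {h} t g≢h =
    cong (λ b → if b then just (1ℚ , t) else consNeg (derivWord g t) h) (dec-false (g ≟ᴳ h) g≢h)

-- The pairing of words

Scaled : ℕ → Set
Scaled n = Maybe (ℚ × Word n)

module _ {n : ℕ} where

  lin : (Word n → ℚ) → Scaled n → ℚ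
  lin Φ nothing = 0ℚ
  lin Φ (just (s , w)) = s * Φ w

  Holds : (Word n → Set) → Scaled n → Set
  Holds R = MAll.All (λ t → R (proj₂ t))

  scaleBy : ℚ → Scaled n → Scaled n
  scaleBy c nothing = nothing
  scaleBy c (just (s , w)) = just (c * s , w)

  bindScaled : (Word n → Scaled n) → Scaled n → Scaled n
  bindScaled f nothing = nothing
  bindScaled f (just (s , w)) = scaleBy s (f w)

  lin-congᴴ : {R : Word n → Set} {Φ Ψ : Word n → ℚ} → (∀ {w} → R w → Φ w ≡ Ψ w) →
    {u : Scaled n} → Holds R u → lin Φ u ≡ lin Ψ u
  lin-congᴴ e (just {s , w} r) = cong (s *_) (e r)
  lin-congᴴ e nothing = refl

  lin-cong : {Φ Ψ : Word n → ℚ} → (∀ w → Φ w ≡ Ψ w) → ∀ u → lin Φ u ≡ lin Ψ u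
  lin-cong e nothing = refl
  lin-cong e (just (s , w)) = cong (s *_) (e w)

  lin-zeroᴴ : {R : Word n → Set} {Φ : Word n → ℚ} → (∀ {w} → R w → Φ w ≡ 0ℚ) →
    {u : Scaled n} → Holds R u → lin Φ u ≡ 0ℚ
  lin-zeroᴴ e (just {s , w} r) = trans (cong (s *_) (e r)) (QP.*-zeroʳ s)
  lin-zeroᴴ e nothing = refl

  lin-zero : {Φ : Word n → ℚ} → (∀ w → Φ w ≡ 0ℚ) → ∀ u → lin Φ u ≡ 0ℚ
  lin-zero e nothing = refl
  lin-zero e (just (s , w)) = trans (cong (s *_) (e w)) (QP.*-zeroʳ s)

  lin-neg : (Φ : Word n → ℚ) (u : Scaled n) → lin (λ w → - Φ w) u ≡ - lin Φ u
  lin-neg Φ nothing = refl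
  lin-neg Φ (just (s , w)) = sym (QP.neg-distribʳ-* s (Φ w))

  lin-consNeg : (Φ : Word n → ℚ) (x : Gen n) (u : Scaled n) → lin Φ (consNeg u x) ≡ - lin (Φ ∘ (x ∷_)) u
  lin-consNeg Φ x nothing = refl
  lin-consNeg Φ x (just (s , w)) = sym (QP.neg-distribˡ-* s (Φ (x ∷ w)))

  lin-comm : (F : Word n → Word n → ℚ) (u v : Scaled n) →
    lin (λ w → lin (F w) v) u ≡ lin (λ w′ → lin (λ w → F w w′) u) v
  lin-comm F nothing nothing = refl
  lin-comm F nothing (just (s , w)) = sym (QP.*-zeroʳ s)
  lin-comm F (just (s , w)) nothing = QP.*-zeroʳ s
  lin-comm F (just (s , w)) (just (s′ , w′)) =
    solve 3 (λ a b c → a :* (b :* c) := b :* (a :* c)) refl s s′ (F w w′)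

  lin-scaleBy : (Φ : Word n → ℚ) (c : ℚ) (u : Scaled n) → lin Φ (scaleBy c u) ≡ c * lin Φ u
  lin-scaleBy Φ c nothing = sym (QP.*-zeroʳ c)
  lin-scaleBy Φ c (just (s , w)) = QP.*-assoc c s (Φ w)

  lin-bindScaled : (Φ : Word n → ℚ) (f : Word n → Scaled n) (u : Scaled n) →
    lin Φ (bindScaled f u) ≡ lin (lin Φ ∘ f) u
  lin-bindScaled Φ f nothing = refl
  lin-bindScaled Φ f (just (s , w)) = lin-scaleBy Φ s (f w)

  Holds-consNeg : {R : Word n → Set} (x : Gen n) {u : Scaled n} → Holds (R ∘ (x ∷_)) u → Holds R (consNeg u x)
  Holds-consNeg x (just r) = just r
  Holds-consNeg x nothing = nothing

  Holds-scaleBy : {R : Word n → Set} (c : ℚ) {u : Scaled n} → Holds R u → Holds R (scaleBy c u)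
  Holds-scaleBy c (just r) = just r
  Holds-scaleBy c nothing = nothing

  Holds-bindScaled : {R S : Word n → Set} (f : Word n → Scaled n) → (∀ {w} → R w → Holds S (f w)) →
    {u : Scaled n} → Holds R u → Holds S (bindScaled f u)
  Holds-bindScaled f h (just {s , w} r) = Holds-scaleBy s (h r)
  Holds-bindScaled f h nothing = nothing

module _ {n : ℕ} where
  open ≡-Reasoning

  derivWord-ind : (h : Gen n) (P : Word n → Scaled n → Set) → P [] nothing →
    (∀ t → P (h ∷ t) (just (1ℚ , t))) →
    (∀ {y} t → h ≢ y → P t (derivWord h t) → P (y ∷ t) (consNeg (derivWord h t) y)) →
    ∀ m → P m (derivWord h m)
  derivWord-ind h P nil hit miss [] = nil
  derivWord-ind h P nil hit miss (y ∷ t) with h ≟ᴳ y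
  ... | yes refl = subst (P (h ∷ t)) (sym (derivWord-here h t)) (hit t)
  ... | no h≢y = subst (P (y ∷ t)) (sym (derivWord-there t h≢y)) (miss t h≢y (derivWord-ind h P nil hit miss t))

  derivWord-∉ : (g : Gen n) (m : Word n) → All (g ≢_) m → derivWord g m ≡ nothing
  derivWord-∉ g = derivWord-ind g (λ m u → All (g ≢_) m → u ≡ nothing) (λ _ → refl)
    (λ t g∉ → ⊥-elim (All.head g∉ refl)) (λ t _ ih g∉ → cong (λ u → consNeg u _) (ih (All.tail g∉)))

  derivWord-All : {R : Gen n → Set} (h : Gen n) (m : Word n) → All R m → Holds (All R) (derivWord h m)
  derivWord-All {R} h = derivWord-ind h (λ m u → All R m → Holds (All R) u) (λ _ → nothing)
    (λ t rs → just (All.tail rs)) (λ t _ ih rs → Holds-consNeg _ (MAll.map (All.head rs ∷_) (ih (All.tail rs))))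

  derivWord-Unique : (h : Gen n) (m : Word n) → Unique m → Holds Unique (derivWord h m)
  derivWord-Unique h = derivWord-ind h (λ m u → Unique m → Holds Unique u) (λ _ → nothing)
    (λ t u → just (AllPairs.tail u))
    (λ t _ ih u → Holds-consNeg _ (MAll.zipWith (λ p → proj₁ p ∷ proj₂ p)
      (derivWord-All h t (AllPairs.head u) , ih (AllPairs.tail u))))

  derivWord-removes : (h : Gen n) (m : Word n) → Unique m → Holds (All (h ≢_)) (derivWord h m)
  derivWord-removes h = derivWord-ind h (λ m u → Unique m → Holds (All (h ≢_)) u) (λ _ → nothing)
    (λ t u → just (AllPairs.head u)) (λ t h≢y ih u → Holds-consNeg _ (MAll.map (h≢y ∷_) (ih (AllPairs.tail u))))

  Holds-universal : {R : Word n → Set} → (∀ w → R w) → ∀ u → Holds R u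
  Holds-universal r nothing = nothing
  Holds-universal r (just (s , w)) = just (r w)

  derivWord-∈ : {x : Gen n} (h : Gen n) (m : Word n) → x ∈ m → x ≢ h → Holds (x ∈_) (derivWord h m)
  derivWord-∈ {x} h = derivWord-ind h (λ m u → x ∈ m → x ≢ h → Holds (x ∈_) u) (λ ())
    (λ { t (here x≡h) x≢h → ⊥-elim (x≢h x≡h) ; t (there x∈t) x≢h → just x∈t })
    (λ { t _ ih (here x≡y) x≢h → Holds-consNeg _ (Holds-universal (λ _ → here x≡y) (derivWord h t))
       ; t _ ih (there x∈t) x≢h → Holds-consNeg _ (MAll.map there (ih x∈t x≢h)) })

  infixr 5 _⊳_
  _⊳_ : Gen n → (Word n → ℚ) → Word n → ℚ
  (g ⊳ Φ) m = lin Φ (derivWord g m)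

  ⊳-here : (g : Gen n) (Φ : Word n → ℚ) (m : Word n) → (g ⊳ Φ) (g ∷ m) ≡ Φ m
  ⊳-here g Φ m = trans (cong (lin Φ) (derivWord-here g m)) (QP.*-identityˡ (Φ m))

  ⊳-there : {g x : Gen n} (Φ : Word n → ℚ) (m : Word n) → g ≢ x → (g ⊳ Φ) (x ∷ m) ≡ - (g ⊳ Φ ∘ (x ∷_)) m
  ⊳-there {g} {x} Φ m g≢x = trans (cong (lin Φ) (derivWord-there m g≢x)) (lin-consNeg Φ x (derivWord g m))

  ⊳-∉ : {g : Gen n} (Φ : Word n → ℚ) {m : Word n} → All (g ≢_) m → (g ⊳ Φ) m ≡ 0ℚ
  ⊳-∉ {g} Φ {m} g∉m = cong (lin Φ) (derivWord-∉ g m g∉m)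

  ⊳-cong : (g : Gen n) {Φ Ψ : Word n → ℚ} → (∀ w → Φ w ≡ Ψ w) → ∀ m → (g ⊳ Φ) m ≡ (g ⊳ Ψ) m
  ⊳-cong g e m = lin-cong e (derivWord g m)

  ⊳-neg : (g : Gen n) (Φ : Word n → ℚ) (m : Word n) → (g ⊳ (λ w → - Φ w)) m ≡ - (g ⊳ Φ) m
  ⊳-neg g Φ m = lin-neg Φ (derivWord g m)

  ⊳-anticomm : {g h : Gen n} → g ≢ h → ∀ (Φ : Word n → ℚ) m → (g ⊳ h ⊳ Φ) m ≡ - (h ⊳ g ⊳ Φ) m
  ⊳-anticomm g≢h Φ [] = refl
  ⊳-anticomm {g} {h} g≢h Φ (x ∷ m) with g ≟ᴳ x | h ≟ᴳ x
  ... | yes refl | yes refl = ⊥-elim (g≢h refl)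
  ... | yes refl | no h≢g = begin
    (g ⊳ h ⊳ Φ) (g ∷ m)
      ≡⟨ ⊳-here g _ m ⟩
    (h ⊳ Φ) m
      ≡⟨ ⊳-cong h (λ w → ⊳-here g Φ w) m ⟨
    (h ⊳ (g ⊳ Φ) ∘ (g ∷_)) m
      ≡⟨ ⁻¹-involutive _ ⟨
    - - (h ⊳ (g ⊳ Φ) ∘ (g ∷_)) m
      ≡⟨ cong -_ (⊳-there (g ⊳ Φ) m h≢g) ⟨
    - (h ⊳ g ⊳ Φ) (g ∷ m) ∎
  ... | no g≢h′ | yes refl = begin
    (g ⊳ h ⊳ Φ) (h ∷ m)
      ≡⟨ ⊳-there (h ⊳ Φ) m g≢h′ ⟩
    - (g ⊳ (h ⊳ Φ) ∘ (h ∷_)) m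
      ≡⟨ cong -_ (⊳-cong g (λ w → ⊳-here h Φ w) m) ⟩
    - (g ⊳ Φ) m
      ≡⟨ cong -_ (⊳-here h _ m) ⟨
    - (h ⊳ g ⊳ Φ) (h ∷ m) ∎
  ... | no g≢x | no h≢x = begin
    (g ⊳ h ⊳ Φ) (x ∷ m)
      ≡⟨ ⊳-there (h ⊳ Φ) m g≢x ⟩
    - (g ⊳ (h ⊳ Φ) ∘ (x ∷_)) m
      ≡⟨ cong -_ (⊳-cong g (λ w → ⊳-there Φ w h≢x) m) ⟩
    - (g ⊳ (λ w → - (h ⊳ Φx) w)) m
      ≡⟨ cong -_ (⊳-neg g (h ⊳ Φx) m) ⟩
    - - (g ⊳ h ⊳ Φx) m
      ≡⟨ cong (-_ ∘ -_) (⊳-anticomm g≢h Φx m) ⟩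
    - - - (h ⊳ g ⊳ Φx) m
      ≡⟨ cong (-_ ∘ -_) (⊳-neg h (g ⊳ Φx) m) ⟨
    - - (h ⊳ (λ w → - (g ⊳ Φx) w)) m
      ≡⟨ cong (-_ ∘ -_) (⊳-cong h (λ w → ⊳-there Φ w g≢x) m) ⟨
    - - (h ⊳ (g ⊳ Φ) ∘ (x ∷_)) m
      ≡⟨ cong -_ (⊳-there (g ⊳ Φ) m h≢x) ⟨
    - (h ⊳ g ⊳ Φ) (x ∷ m) ∎
    where
    Φx : Word n → ℚ
    Φx = Φ ∘ (x ∷_)

  ⟨_∣_⟩ : Word n → Word n → ℚ
  ⟨ [] ∣ [] ⟩ = 1ℚ
  ⟨ [] ∣ _ ∷ _ ⟩ = 0ℚ
  ⟨ h ∷ t ∣ m ⟩ = (h ⊳ ⟨ t ∣_⟩) m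

  ⟨⟩-derivWord : (g : Gen n) (w m : Word n) → (g ⊳ ⟨_∣ m ⟩) w ≡ ⟨ w ∣ g ∷ m ⟩
  ⟨⟩-derivWord g [] m = refl
  ⟨⟩-derivWord g (h ∷ t) m with g ≟ᴳ h
  ... | yes refl = trans (⊳-here g _ t) (sym (⊳-here g _ m))
  ... | no g≢h = begin
    (g ⊳ ⟨_∣ m ⟩) (h ∷ t)
      ≡⟨ ⊳-there ⟨_∣ m ⟩ t g≢h ⟩
    - (g ⊳ (λ v → (h ⊳ ⟨ v ∣_⟩) m)) t
      ≡⟨ cong -_ (lin-comm (λ v m′ → ⟨ v ∣ m′ ⟩) (derivWord g t) (derivWord h m)) ⟩
    - (h ⊳ (λ m′ → (g ⊳ ⟨_∣ m′ ⟩) t)) m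
      ≡⟨ cong -_ (⊳-cong h (⟨⟩-derivWord g t) m) ⟩
    - (h ⊳ ⟨ t ∣_⟩ ∘ (g ∷_)) m
      ≡⟨ ⊳-there ⟨ t ∣_⟩ m (g≢h ∘ sym) ⟨
    ⟨ h ∷ t ∣ g ∷ m ⟩ ∎

  ⟨⟩-∉ : {x : Gen n} (w m : Word n) → x ∈ m → All (x ≢_) w → ⟨ w ∣ m ⟩ ≡ 0ℚ
  ⟨⟩-∉ [] (_ ∷ _) _ _ = refl
  ⟨⟩-∉ (h ∷ t) m x∈m (x≢h ∷ x∉t) = lin-zeroᴴ (λ {m′} x∈m′ → ⟨⟩-∉ t m′ x∈m′ x∉t) (derivWord-∈ h m x∈m x≢h)

  ⟨⟩-self : (w : Word n) → ⟨ w ∣ w ⟩ ≡ 1ℚ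
  ⟨⟩-self [] = refl
  ⟨⟩-self (h ∷ t) = trans (⊳-here h _ t) (⟨⟩-self t)

  _<ᶜ_ : Gen n → Gen n → Set
  g <ᶜ h = code g < code h

  Increasing : Word n → Set
  Increasing = AllPairs _<ᶜ_

  <⇒≢ : {g h : Gen n} → g <ᶜ h → g ≢ h
  <⇒≢ g<h g≡h = ℕP.<-irrefl (cong code g≡h) g<h

  insertSorted-ind : (g : Gen n) (P : Word n → Scaled n → Set) → P [] (just (1ℚ , g ∷ [])) →
    (∀ {h} t → g <ᶜ h → P (h ∷ t) (just (1ℚ , g ∷ h ∷ t))) →
    (∀ t → P (g ∷ t) nothing) →
    (∀ {h} t → h <ᶜ g → P t (insertSorted g t) → P (h ∷ t) (consNeg (insertSorted g t) h)) →
    ∀ l → P l (insertSorted g l)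
  insertSorted-ind g P nil lt eq gt [] = nil
  insertSorted-ind g P nil lt eq gt (h ∷ t) with code g ℕ.<ᵇ code h in g<ᵇh
  ... | true = lt t (ℕP.<ᵇ⇒< (code g) (code h) (subst T (sym g<ᵇh) _))
  ... | false with code g ℕ.≡ᵇ code h in g≡ᵇh
  ...   | true rewrite code-injective g h (ℕP.≡ᵇ⇒≡ (code g) (code h) (subst T (sym g≡ᵇh) _)) = eq t
  ...   | false = gt t (ℕP.≤∧≢⇒< (ℕP.≮⇒≥ g≮h) (λ h≡g → subst T g≡ᵇh (ℕP.≡⇒≡ᵇ _ _ (sym h≡g))))
                   (insertSorted-ind g P nil lt eq gt t)
    where
    g≮h : ¬ g <ᶜ h
    g≮h g<h = subst T g<ᵇh (ℕP.<⇒<ᵇ g<h)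

  ⟨⟩-insertSorted : (g : Gen n) (l m : Word n) → Unique m → ⟨ g ∷ l ∣ m ⟩ ≡ lin ⟨_∣ m ⟩ (insertSorted g l)
  ⟨⟩-insertSorted g = insertSorted-ind g (λ l u → ∀ m → Unique m → ⟨ g ∷ l ∣ m ⟩ ≡ lin ⟨_∣ m ⟩ u)
    (λ m _ → sym (QP.*-identityˡ _)) (λ t _ m _ → sym (QP.*-identityˡ _))
    (λ t m um → lin-zeroᴴ (⊳-∉ _) (derivWord-removes g m um))
    (λ {h} t h<g ih m um → begin
      (g ⊳ h ⊳ ⟨ t ∣_⟩) m
        ≡⟨ ⊳-anticomm (<⇒≢ h<g ∘ sym) _ m ⟩
      - (h ⊳ (λ m′ → ⟨ g ∷ t ∣ m′ ⟩)) m
        ≡⟨ cong -_ (lin-congᴴ (λ {m′} → ih m′) (derivWord-Unique h m um)) ⟩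
      - (h ⊳ (λ m′ → lin ⟨_∣ m′ ⟩ (insertSorted g t))) m
        ≡⟨ cong -_ (lin-comm (λ m′ w → ⟨ w ∣ m′ ⟩) (derivWord h m) (insertSorted g t)) ⟩
      - lin (λ w → ⟨ h ∷ w ∣ m ⟩) (insertSorted g t)
        ≡⟨ lin-consNeg ⟨_∣ m ⟩ h (insertSorted g t) ⟨
      lin ⟨_∣ m ⟩ (consNeg (insertSorted g t) h) ∎)

  normWord-∷ : (g : Gen n) (w : Word n) → normWord (g ∷ w) ≡ bindScaled (insertSorted g) (normWord w)
  normWord-∷ g w with normWord w
  ... | nothing = refl
  ... | just (s , l) with insertSorted g l
  ...   | nothing = refl
  ...   | just (s′ , l′) = refl

  ⟨⟩-normWord : (w m : Word n) → Unique m → ⟨ w ∣ m ⟩ ≡ lin ⟨_∣ m ⟩ (normWord w)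
  ⟨⟩-normWord [] m _ = sym (QP.*-identityˡ _)
  ⟨⟩-normWord (g ∷ w) m um = begin
    (g ⊳ ⟨ w ∣_⟩) m
      ≡⟨ lin-congᴴ (λ {m′} → ⟨⟩-normWord w m′) (derivWord-Unique g m um) ⟩
    (g ⊳ (λ m′ → lin ⟨_∣ m′ ⟩ (normWord w))) m
      ≡⟨ lin-comm (λ m′ v → ⟨ v ∣ m′ ⟩) (derivWord g m) (normWord w) ⟩
    lin (λ v → ⟨ g ∷ v ∣ m ⟩) (normWord w)
      ≡⟨ lin-cong (λ v → ⟨⟩-insertSorted g v m um) (normWord w) ⟩
    lin (lin ⟨_∣ m ⟩ ∘ insertSorted g) (normWord w)
      ≡⟨ lin-bindScaled ⟨_∣ m ⟩ (insertSorted g) (normWord w) ⟨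
    lin ⟨_∣ m ⟩ (bindScaled (insertSorted g) (normWord w))
      ≡⟨ cong (lin ⟨_∣ m ⟩) (normWord-∷ g w) ⟨
    lin ⟨_∣ m ⟩ (normWord (g ∷ w)) ∎

  insertSorted-All : {R : Gen n → Set} (g : Gen n) (l : Word n) → All R l → R g → Holds (All R) (insertSorted g l)
  insertSorted-All {R} g l rl rg = insertSorted-ind g (λ l u → All R l → Holds (All R) u)
    (λ _ → just (rg ∷ [])) (λ t _ rs → just (rg ∷ rs)) (λ t _ → nothing)
    (λ t _ ih rs → Holds-consNeg _ (MAll.map (All.head rs ∷_) (ih (All.tail rs)))) l rl

  insertSorted-Increasing : (g : Gen n) (l : Word n) → Increasing l → Holds Increasing (insertSorted g l)
  insertSorted-Increasing g = insertSorted-ind g (λ l u → Increasing l → Holds Increasing u)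
    (λ _ → just ([] ∷ []))
    (λ t g<h inc → just ((g<h ∷ All.map (ℕP.<-trans g<h) (AllPairs.head inc)) ∷ inc))
    (λ t _ → nothing)
    (λ t h<g ih inc → Holds-consNeg _ (MAll.zipWith (λ p → proj₁ p ∷ proj₂ p)
      (insertSorted-All g t (AllPairs.head inc) h<g , ih (AllPairs.tail inc))))

  normWord-Increasing : (w : Word n) → Holds Increasing (normWord w)
  normWord-Increasing [] = just []
  normWord-Increasing (g ∷ w) = subst (Holds Increasing) (sym (normWord-∷ g w))
    (Holds-bindScaled (insertSorted g) (insertSorted-Increasing g _) (normWord-Increasing w))

  Increasing⇒Unique : {w : Word n} → Increasing w → Unique w
  Increasing⇒Unique = AllPairs.map <⇒≢

  ⟨⟩-increasing-≢ : (w m : Word n) → Increasing w → Increasing m → w ≢ m → ⟨ w ∣ m ⟩ ≡ 0ℚ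
  ⟨⟩-increasing-≢ [] [] _ _ w≢m = ⊥-elim (w≢m refl)
  ⟨⟩-increasing-≢ [] (_ ∷ _) _ _ _ = refl
  ⟨⟩-increasing-≢ (h ∷ t) [] _ _ _ = refl
  ⟨⟩-increasing-≢ (h ∷ t) (x ∷ m) (h<t ∷ inc-t) (x<m ∷ inc-m) w≢m with ℕP.<-cmp (code h) (code x)
  ... | tri< h<x _ _ = ⊳-∉ {h} ⟨ t ∣_⟩ (<⇒≢ h<x ∷ All.map (<⇒≢ ∘ ℕP.<-trans h<x) x<m)
  ... | tri≈ _ h≡x _ with refl ← code-injective h x h≡x =
    trans (⊳-here h _ m) (⟨⟩-increasing-≢ t m inc-t inc-m (w≢m ∘ cong (h ∷_)))
  ... | tri> _ _ x<h = trans (⊳-there _ m (<⇒≢ x<h ∘ sym))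
    (cong -_ (lin-zero (λ w → ⟨⟩-∉ t (x ∷ w) (here refl) (All.map (<⇒≢ ∘ ℕP.<-trans x<h) h<t)) (derivWord h m)))

  derivWord-nonUnique : (h : Gen n) (m : Word n) → ¬ Unique m → Holds (λ m′ → ¬ Unique m′ ⊎ h ∈ m′) (derivWord h m)
  derivWord-nonUnique h = derivWord-ind h (λ m u → ¬ Unique m → Holds (λ m′ → ¬ Unique m′ ⊎ h ∈ m′) u)
    (λ nu → ⊥-elim (nu []))
    (λ t nu → just (case-∈ h t nu (λ h∈t → inj₂ h∈t) inj₁))
    (λ {y} t h≢y ih nu → Holds-consNeg y (case-∈ y t nu
      (λ y∈t → MAll.map (λ y∈m′ → inj₁ (λ u → All.lookup (AllPairs.head u) y∈m′ refl)) (derivWord-∈ h t y∈t (h≢y ∘ sym)))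
      (λ nu-t → MAll.map [ (λ nu′ → inj₁ (nu′ ∘ AllPairs.tail)) , (λ h∈m′ → inj₂ (there h∈m′)) ] (ih nu-t))))
    where
    case-∈ : ∀ {A : Set} x t → ¬ Unique (x ∷ t) → (x ∈ t → A) → (¬ Unique t → A) → A
    case-∈ x t nu yes-∈ no-∈ with Any.any? (x ≟ᴳ_) t
    ... | yes x∈t = yes-∈ x∈t
    ... | no x∉t = no-∈ (λ ut → nu (AllP.¬Any⇒All¬ t x∉t ∷ ut))

  ⟨⟩-nonUnique : (w m : Word n) → Unique w → ¬ Unique m → ⟨ w ∣ m ⟩ ≡ 0ℚ
  ⟨⟩-nonUnique [] [] _ nu = ⊥-elim (nu [])
  ⟨⟩-nonUnique [] (_ ∷ _) _ _ = refl
  ⟨⟩-nonUnique (h ∷ t) m (h∉t ∷ ut) nu = lin-zeroᴴ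
    [ (λ nu′ → ⟨⟩-nonUnique t _ ut nu′) , (λ h∈m′ → ⟨⟩-∉ t _ h∈m′ h∉t) ] (derivWord-nonUnique h m nu)

  -- The pairing of elements

  ⟪_∣_⟫ : Elt n → Word n → ℚ
  ⟪ f ∣ m ⟫ = ∑ (λ t → proj₁ t * ⟨ proj₂ t ∣ m ⟩) f

  WordsUnique : Elt n → Set
  WordsUnique = All (Unique ∘ proj₂)

  ⟪⟫-scaleM : (c : ℚ) (u : Scaled n) (m : Word n) → ⟪ scaleM c u ∣ m ⟫ ≡ c * lin ⟨_∣ m ⟩ u
  ⟪⟫-scaleM c nothing m = sym (QP.*-zeroʳ c)
  ⟪⟫-scaleM c (just (s , l)) m = trans (QP.+-identityʳ _) (QP.*-assoc c s ⟨ l ∣ m ⟩)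

  ⟪⟫-normalize-Unique : (f : Elt n) (m : Word n) → Unique m → ⟪ normalize f ∣ m ⟫ ≡ ⟪ f ∣ m ⟫
  ⟪⟫-normalize-Unique f m um = trans (∑-concatMap _ normTerm f) (∑-cong (λ t → trans
    (⟪⟫-scaleM (proj₁ t) (normWord (proj₂ t)) m) (cong (proj₁ t *_) (sym (⟨⟩-normWord (proj₂ t) m um)))) f)

  scaleM-All : {R : Word n → Set} (c : ℚ) {u : Scaled n} → Holds R u → All (R ∘ proj₂) (scaleM c u)
  scaleM-All c (just r) = r ∷ []
  scaleM-All c nothing = []

  normalize-Increasing : (f : Elt n) → All (Increasing ∘ proj₂) (normalize f)
  normalize-Increasing [] = []
  normalize-Increasing ((c , w) ∷ f) = AllP.++⁺ (scaleM-All c (normWord-Increasing w)) (normalize-Increasing f)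

  ⟪⟫-nonUnique : (f : Elt n) (m : Word n) → WordsUnique f → ¬ Unique m → ⟪ f ∣ m ⟫ ≡ 0ℚ
  ⟪⟫-nonUnique f m uf nu = ∑-zeroᴬ (All.map (λ {t} ut → trans (cong (proj₁ t *_) (⟨⟩-nonUnique _ m ut nu))
    (QP.*-zeroʳ (proj₁ t))) uf)

  ⟪⟫-normalize : (f : Elt n) (m : Word n) → WordsUnique f → ⟪ normalize f ∣ m ⟫ ≡ ⟪ f ∣ m ⟫
  ⟪⟫-normalize f m uf with unique? _≟ᴳ_ m
  ... | yes um = ⟪⟫-normalize-Unique f m um
  ... | no nu = trans (⟪⟫-nonUnique (normalize f) m (All.map Increasing⇒Unique (normalize-Increasing f)) nu)
                      (sym (⟪⟫-nonUnique f m uf nu))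

  ∂-WordsUnique : (g : Gen n) (f : Elt n) → WordsUnique (∂ g f)
  ∂-WordsUnique g f = concatMap-All (derivTerm g) (λ {t} inc → scaleM-All (proj₁ t)
    (derivWord-Unique g (proj₂ t) (Increasing⇒Unique inc))) (normalize-Increasing f)

  ⟪⟫-∂ : (g : Gen n) (f : Elt n) (m : Word n) → WordsUnique f → ⟪ ∂ g f ∣ m ⟫ ≡ ⟪ f ∣ g ∷ m ⟫
  ⟪⟫-∂ g f m uf = begin
    ⟪ concatMap (derivTerm g) (normalize f) ∣ m ⟫
      ≡⟨ ∑-concatMap _ (derivTerm g) (normalize f) ⟩
    ∑ (λ t → ⟪ derivTerm g t ∣ m ⟫) (normalize f)
      ≡⟨ ∑-cong (λ t → trans (⟪⟫-scaleM (proj₁ t) (derivWord g (proj₂ t)) m)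
        (cong (proj₁ t *_) (⟨⟩-derivWord g (proj₂ t) m))) (normalize f) ⟩
    ⟪ normalize f ∣ g ∷ m ⟫
      ≡⟨ ⟪⟫-normalize f (g ∷ m) uf ⟩
    ⟪ f ∣ g ∷ m ⟫ ∎

  coeffTerm : Word n → ℚ × Word n → ℚ
  coeffTerm m t = if does (listDec ℕP._≟_ (map code (proj₂ t)) (map code m)) then proj₁ t else 0ℚ

  coeff≡∑coeffTerm : (f : Elt n) (m : Word n) → coeff f m ≡ ∑ (coeffTerm m) (normalize f)
  coeff≡∑coeffTerm f m = trans (foldr-+-map proj₁ (filter D? (normalize f))) (∑-filter D? proj₁ (normalize f))
    where
    D? : (t : ℚ × Word n) → Dec (map code (proj₂ t) ≡ map code m)
    D? t = listDec ℕP._≟_ (map code (proj₂ t)) (map code m)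

  coeffTerm-Increasing : (m : Word n) (c : ℚ) (w : Word n) → Increasing w → Increasing m →
    coeffTerm m (c , w) ≡ c * ⟨ w ∣ m ⟩
  coeffTerm-Increasing m c w inc-w inc-m with listDec ℕP._≟_ (map code w) (map code m)
  ... | yes e with refl ← LP.map-injective (λ {g} {h} → code-injective g h) e =
    sym (trans (cong (c *_) (⟨⟩-self w)) (QP.*-identityʳ c))
  ... | no ne = sym (trans (cong (c *_) (⟨⟩-increasing-≢ w m inc-w inc-m (ne ∘ cong (map code)))) (QP.*-zeroʳ c))

  coeffTerm-nonIncreasing : (m : Word n) (c : ℚ) (w : Word n) → Increasing w → ¬ Increasing m →
    coeffTerm m (c , w) ≡ 0ℚ
  coeffTerm-nonIncreasing m c w inc-w ¬inc-m with listDec ℕP._≟_ (map code w) (map code m)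
  ... | yes e with refl ← LP.map-injective (λ {g} {h} → code-injective g h) e = ⊥-elim (¬inc-m inc-w)
  ... | no _ = refl

  ⟪⟫-zero⇒IsZero : (f : Elt n) → (∀ m → ⟪ f ∣ m ⟫ ≡ 0ℚ) → IsZero f
  ⟪⟫-zero⇒IsZero f f≡0 m with AllPairs.allPairs? (λ g h → code g ℕ.<? code h) m
  ... | yes inc-m = begin
    coeff f m
      ≡⟨ coeff≡∑coeffTerm f m ⟩
    ∑ (coeffTerm m) (normalize f)
      ≡⟨ ∑-congᴬ (All.map (λ {t} inc → coeffTerm-Increasing m (proj₁ t) (proj₂ t) inc inc-m)
        (normalize-Increasing f)) ⟩
    ⟪ normalize f ∣ m ⟫
      ≡⟨ ⟪⟫-normalize-Unique f m (Increasing⇒Unique inc-m) ⟩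
    ⟪ f ∣ m ⟫
      ≡⟨ f≡0 m ⟩
    0ℚ ∎
  ... | no ¬inc-m = trans (coeff≡∑coeffTerm f m) (∑-zeroᴬ (All.map
    (λ {t} inc → coeffTerm-nonIncreasing m (proj₁ t) (proj₂ t) inc ¬inc-m) (normalize-Increasing f)))

  consIf : Bool → Gen n → Word n → Word n
  consIf b g m = if b then g ∷ m else m

  mulPolar : Bool → Bool → Bool → Fin n → Word n → Word n
  mulPolar h k l i m = consIf l (ρ i) (consIf k (ξ i) (consIf h (θ i) m))

  D-WordsUnique : (b : Bool) (g : Gen n) (f : Elt n) → WordsUnique f → WordsUnique (D b g f)
  D-WordsUnique true g f _ = ∂-WordsUnique g f
  D-WordsUnique false g f uf = uf

  ⟪⟫-D : (b : Bool) (g : Gen n) (f : Elt n) (m : Word n) → WordsUnique f → ⟪ D b g f ∣ m ⟫ ≡ ⟪ f ∣ consIf b g m ⟫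
  ⟪⟫-D true g f m uf = ⟪⟫-∂ g f m uf
  ⟪⟫-D false g f m uf = refl

  ⟪⟫-polarized : (h k l : Bool) (f : Elt n) (m : Word n) → WordsUnique f →
    ⟪ polarized h k l f ∣ m ⟫ ≡ ∑ (λ i → ⟪ f ∣ mulPolar h k l i m ⟫) (allFin n)
  ⟪⟫-polarized h k l f m uf = trans (∑-concatMap _ _ (allFin n)) (∑-cong ⟪⟫-component (allFin n))
    where
    ⟪⟫-component : ∀ i → ⟪ D h (θ i) (D k (ξ i) (D l (ρ i) f)) ∣ m ⟫ ≡ ⟪ f ∣ mulPolar h k l i m ⟫
    ⟪⟫-component i = begin
      ⟪ D h (θ i) (D k (ξ i) (D l (ρ i) f)) ∣ m ⟫
        ≡⟨ ⟪⟫-D h (θ i) _ m (D-WordsUnique k (ξ i) _ uf-l) ⟩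
      ⟪ D k (ξ i) (D l (ρ i) f) ∣ consIf h (θ i) m ⟫
        ≡⟨ ⟪⟫-D k (ξ i) _ _ uf-l ⟩
      ⟪ D l (ρ i) f ∣ consIf k (ξ i) (consIf h (θ i) m) ⟫
        ≡⟨ ⟪⟫-D l (ρ i) f _ uf ⟩
      ⟪ f ∣ mulPolar h k l i m ⟫ ∎
      where
      uf-l : WordsUnique (D l (ρ i) f)
      uf-l = D-WordsUnique l (ρ i) f uf

  derivIf : Bool → Gen n → Scaled n → Scaled n
  derivIf b g u = if b then bindScaled (derivWord g) u else u

  derivPolar : Bool → Bool → Bool → Fin n → Word n → Scaled n
  derivPolar h k l i w = derivIf h (θ i) (derivIf k (ξ i) (derivIf l (ρ i) (just (1ℚ , w))))

  lin-derivIf : (b : Bool) (g : Gen n) (u : Scaled n) (m : Word n) → lin ⟨_∣ m ⟩ (derivIf b g u) ≡ lin ⟨_∣ consIf b g m ⟩ u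
  lin-derivIf true g u m = trans (lin-bindScaled ⟨_∣ m ⟩ (derivWord g) u) (lin-cong (λ w → ⟨⟩-derivWord g w m) u)
  lin-derivIf false g u m = refl

  ⟨⟩-mulPolar : (h k l : Bool) (i : Fin n) (w m : Word n) → ⟨ w ∣ mulPolar h k l i m ⟩ ≡ lin ⟨_∣ m ⟩ (derivPolar h k l i w)
  ⟨⟩-mulPolar h k l i w m = sym (begin
    lin ⟨_∣ m ⟩ (derivPolar h k l i w)
      ≡⟨ lin-derivIf h (θ i) _ m ⟩
    lin ⟨_∣ consIf h (θ i) m ⟩ (derivIf k (ξ i) (derivIf l (ρ i) (just (1ℚ , w))))
      ≡⟨ lin-derivIf k (ξ i) _ _ ⟩
    lin ⟨_∣ consIf k (ξ i) (consIf h (θ i) m) ⟩ (derivIf l (ρ i) (just (1ℚ , w)))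
      ≡⟨ lin-derivIf l (ρ i) _ _ ⟩
    1ℚ * ⟨ w ∣ mulPolar h k l i m ⟩
      ≡⟨ QP.*-identityˡ _ ⟩
    ⟨ w ∣ mulPolar h k l i m ⟩ ∎)

-- Signs of permutations

occurs : ∀ {n} → Fin n → List (Fin n) → Bool
occurs i = any (λ j → toℕ i ℕ.≡ᵇ toℕ j)

noDup : ∀ {n} → List (Fin n) → Bool
noDup [] = true
noDup (i ∷ l) = not (occurs i l) ∧ noDup l

module _ {n : ℕ} (elem : Fin n → List (Fin n) → Bool) (nodup : List (Fin n) → Bool)
  (elem-[] : ∀ i → elem i [] ≡ false) (elem-∷ : ∀ i j l → elem i (j ∷ l) ≡ ((toℕ i ℕ.≡ᵇ toℕ j) ∨ elem i l))
  (nodup-[] : nodup [] ≡ true) (nodup-∷ : ∀ i l → nodup (i ∷ l) ≡ (not (elem i l) ∧ nodup l)) where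

  private
    elem≗occurs : ∀ i l → elem i l ≡ occurs i l
    elem≗occurs i [] = elem-[] i
    elem≗occurs i (j ∷ l) = trans (elem-∷ i j l) (cong ((toℕ i ℕ.≡ᵇ toℕ j) ∨_) (elem≗occurs i l))

  nodup≗noDup : ∀ l → nodup l ≡ noDup l
  nodup≗noDup [] = nodup-[]
  nodup≗noDup (i ∷ l) = trans (nodup-∷ i l) (cong₂ (λ a b → not a ∧ b) (elem≗occurs i l) (nodup≗noDup l))

module _ {n : ℕ} where

  -- symGroup filters allTables with a duplicate test that Defs keeps private; unification
  -- recovers the test, and nodup≗noDup identifies it with noDup.
  private
    symGroup-filter : Σ (Perm n → Set) λ P → Σ (Decidable P) λ P? → symGroup n ≡ filter P? (allTables n n)
    symGroup-filter = _ , _ , refl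

    symGroup-test : Decidable (proj₁ symGroup-filter)
    symGroup-test = proj₁ (proj₂ symGroup-filter)

    symGroup-test≡noDup : ∀ σ → does (symGroup-test σ) ≡ noDup (toList σ)
    symGroup-test≡noDup σ with nodup≗noDup _ _ (λ _ → refl) (λ _ _ _ → refl) refl (λ _ _ → refl) | toList σ
    ... | nodup≗noDup′ | l = nodup≗noDup′ l

  symGroup-noDup : All (λ σ → T (noDup (toList σ))) (symGroup n)
  symGroup-noDup = subst (All _) (sym (proj₂ (proj₂ symGroup-filter)))
    (All.map (λ {σ} p → subst T (symGroup-test≡noDup σ) (dec-true′ (symGroup-test σ) p))
             (AllP.all-filter symGroup-test (allTables n n)))
    where
    dec-true′ : ∀ {A : Set} (a? : Dec A) → A → T (does a?)
    dec-true′ a? a = subst T (sym (dec-true a? a)) _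

  ∑-symGroup : (J : Perm n → ℚ) → ∑ J (symGroup n) ≡ ∑ (λ σ → if noDup (toList σ) then J σ else 0ℚ) (allTables n n)
  ∑-symGroup J = begin
    ∑ J (symGroup n)
      ≡⟨ cong (∑ J) (proj₂ (proj₂ symGroup-filter)) ⟩
    ∑ J (filter symGroup-test (allTables n n))
      ≡⟨ ∑-filter symGroup-test J (allTables n n) ⟩
    ∑ (λ σ → if does (symGroup-test σ) then J σ else 0ℚ) (allTables n n)
      ≡⟨ ∑-cong (λ σ → cong (λ b → if b then J σ else 0ℚ) (symGroup-test≡noDup σ)) (allTables n n) ⟩
    ∑ (λ σ → if noDup (toList σ) then J σ else 0ℚ) (allTables n n) ∎
    where open ≡-Reasoning

module _ {A : Set} where

  swapAt : ∀ {k} → ℕ → Vec A k → Vec A k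
  swapAt zero (x ∷ᵥ y ∷ᵥ r) = y ∷ᵥ x ∷ᵥ r
  swapAt (suc a) (x ∷ᵥ r) = x ∷ᵥ swapAt a r
  swapAt _ v = v

  swapAtᴸ : ℕ → List A → List A
  swapAtᴸ zero (x ∷ y ∷ r) = y ∷ x ∷ r
  swapAtᴸ (suc a) (x ∷ r) = x ∷ swapAtᴸ a r
  swapAtᴸ _ l = l

  toList-swapAt : ∀ {k} (a : ℕ) (v : Vec A k) → toList (swapAt a v) ≡ swapAtᴸ a (toList v)
  toList-swapAt zero []ᵥ = refl
  toList-swapAt zero (x ∷ᵥ []ᵥ) = refl
  toList-swapAt zero (x ∷ᵥ y ∷ᵥ r) = refl
  toList-swapAt (suc a) []ᵥ = refl
  toList-swapAt (suc a) (x ∷ᵥ r) = cong (x ∷_) (toList-swapAt a r)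

transposeAt : ℕ → ∀ {k} → Fin k → Fin k
transposeAt zero {suc (suc k)} fz = fs fz
transposeAt zero {suc (suc k)} (fs fz) = fz
transposeAt (suc a) fz = fz
transposeAt (suc a) (fs i) = fs (transposeAt a i)
transposeAt _ i = i

lookup-swapAt : ∀ {A : Set} {k} (a : ℕ) (v : Vec A k) (i : Fin k) → lookup (swapAt a v) i ≡ lookup v (transposeAt a i)
lookup-swapAt zero (x ∷ᵥ []ᵥ) fz = refl
lookup-swapAt zero (x ∷ᵥ y ∷ᵥ r) fz = refl
lookup-swapAt zero (x ∷ᵥ y ∷ᵥ r) (fs fz) = refl
lookup-swapAt zero (x ∷ᵥ y ∷ᵥ r) (fs (fs i)) = refl
lookup-swapAt (suc a) (x ∷ᵥ r) fz = refl
lookup-swapAt (suc a) (x ∷ᵥ r) (fs i) = lookup-swapAt a r i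

module _ {n : ℕ} where
  open ≡-Reasoning

  private
    ≡ᵇ-comm : ∀ a b → (a ℕ.≡ᵇ b) ≡ (b ℕ.≡ᵇ a)
    ≡ᵇ-comm zero zero = refl
    ≡ᵇ-comm zero (suc b) = refl
    ≡ᵇ-comm (suc a) zero = refl
    ≡ᵇ-comm (suc a) (suc b) = ≡ᵇ-comm a b

  occurs-swapAtᴸ : (x : Fin n) (a : ℕ) (l : List (Fin n)) → occurs x (swapAtᴸ a l) ≡ occurs x l
  occurs-swapAtᴸ x zero (y ∷ z ∷ r) = begin
    x≡z ∨ (x≡y ∨ occurs x r)
      ≡⟨ BP.∨-assoc x≡z x≡y _ ⟨
    (x≡z ∨ x≡y) ∨ occurs x r
      ≡⟨ cong (_∨ occurs x r) (BP.∨-comm x≡z x≡y) ⟩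
    (x≡y ∨ x≡z) ∨ occurs x r
      ≡⟨ BP.∨-assoc x≡y x≡z _ ⟩
    x≡y ∨ (x≡z ∨ occurs x r) ∎
    where
    x≡y x≡z : Bool
    x≡y = toℕ x ℕ.≡ᵇ toℕ y
    x≡z = toℕ x ℕ.≡ᵇ toℕ z
  occurs-swapAtᴸ x (suc a) (y ∷ r) = cong ((toℕ x ℕ.≡ᵇ toℕ y) ∨_) (occurs-swapAtᴸ x a r)
  occurs-swapAtᴸ x zero [] = refl
  occurs-swapAtᴸ x zero (y ∷ []) = refl
  occurs-swapAtᴸ x (suc a) [] = refl

  noDup-swapAtᴸ : (a : ℕ) (l : List (Fin n)) → noDup (swapAtᴸ a l) ≡ noDup l
  noDup-swapAtᴸ zero (x ∷ y ∷ r) rewrite ≡ᵇ-comm (toℕ y) (toℕ x) =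
    swap-guards (toℕ x ℕ.≡ᵇ toℕ y) (occurs x r) (occurs y r) (noDup r)
    where
    swap-guards : ∀ e p q d → (not (e ∨ q) ∧ (not p ∧ d)) ≡ (not (e ∨ p) ∧ (not q ∧ d))
    swap-guards true p q d = refl
    swap-guards false true true d = refl
    swap-guards false true false d = refl
    swap-guards false false true d = refl
    swap-guards false false false d = refl
  noDup-swapAtᴸ (suc a) (x ∷ r) = cong₂ (λ p q → not p ∧ q) (occurs-swapAtᴸ x a r) (noDup-swapAtᴸ a r)
  noDup-swapAtᴸ zero [] = refl
  noDup-swapAtᴸ zero (x ∷ []) = refl
  noDup-swapAtᴸ (suc a) [] = refl

  below : Fin n → List (Fin n) → ℕ
  below x xs = length (filter (λ y → toℕ y ℕ.<? toℕ x) xs)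

  below-∷-< : (x y : Fin n) (r : List (Fin n)) → toℕ y < toℕ x → below x (y ∷ r) ≡ suc (below x r)
  below-∷-< x y r y<x = cong length (LP.filter-accept (λ y → toℕ y ℕ.<? toℕ x) y<x)

  below-∷-≮ : (x y : Fin n) (r : List (Fin n)) → ¬ toℕ y < toℕ x → below x (y ∷ r) ≡ below x r
  below-∷-≮ x y r y≮x = cong length (LP.filter-reject (λ y → toℕ y ℕ.<? toℕ x) y≮x)

  below-∷ : (x y : Fin n) → Σ ℕ λ c → ∀ r → below x (y ∷ r) ≡ c ℕ.+ below x r
  below-∷ x y with toℕ y ℕ.<? toℕ x
  ... | yes y<x = 1 , λ r → below-∷-< x y r y<x
  ... | no y≮x = 0 , λ r → below-∷-≮ x y r y≮x

  below-swapAtᴸ : (x : Fin n) (a : ℕ) (l : List (Fin n)) → below x (swapAtᴸ a l) ≡ below x l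
  below-swapAtᴸ x zero (y ∷ z ∷ r) with below-∷ x y | below-∷ x z
  ... | c , ey | d , ez = begin
    below x (z ∷ y ∷ r)
      ≡⟨ trans (ez (y ∷ r)) (cong (d ℕ.+_) (ey r)) ⟩
    d ℕ.+ (c ℕ.+ below x r)
      ≡⟨ +-exchange d c (below x r) ⟩
    c ℕ.+ (d ℕ.+ below x r)
      ≡⟨ sym (trans (ey (z ∷ r)) (cong (c ℕ.+_) (ez r))) ⟩
    below x (y ∷ z ∷ r) ∎
  below-swapAtᴸ x (suc a) (y ∷ r) with below-∷ x y
  ... | c , ey = trans (ey (swapAtᴸ a r)) (trans (cong (c ℕ.+_) (below-swapAtᴸ x a r)) (sym (ey r)))
  below-swapAtᴸ x zero [] = refl
  below-swapAtᴸ x zero (y ∷ []) = refl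
  below-swapAtᴸ x (suc a) [] = refl

  not-occurs⇒All≢ : (x : Fin n) (l : List (Fin n)) → T (not (occurs x l)) → All (x ≢_) l
  not-occurs⇒All≢ x [] _ = []
  not-occurs⇒All≢ x (y ∷ r) t with toℕ x ℕ.≡ᵇ toℕ y in x≡ᵇy
  ... | false = (λ x≡y → subst T x≡ᵇy (ℕP.≡⇒≡ᵇ _ _ (cong toℕ x≡y))) ∷ not-occurs⇒All≢ x r t

  noDup⇒Unique : (l : List (Fin n)) → T (noDup l) → Unique l
  noDup⇒Unique [] _ = []
  noDup⇒Unique (x ∷ l) nd with Equivalence.to BP.T-∧ nd
  ... | x∉l , nd-l = not-occurs⇒All≢ x l x∉l ∷ noDup⇒Unique l nd-l

  noDup⇒lookup-injective : ∀ {k} (σ : Vec (Fin n) k) → T (noDup (toList σ)) → Injective _≡_ _≡_ (lookup σ)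
  noDup⇒lookup-injective σ nd {a} {b} = VUP.lookup-injective (toVecUnique σ (noDup⇒Unique (toList σ) nd)) a b
    where
    toVecUnique : ∀ {k} (v : Vec (Fin n) k) → Unique (toList v) → VU.Unique v
    toVecUnique []ᵥ [] = []
    toVecUnique (x ∷ᵥ v) (x∉v ∷ u) = VAllP.toList⁻ x∉v ∷ toVecUnique v u

  inversions-swapAtᴸ : (a : ℕ) (l : List (Fin n)) → suc a < length l → T (noDup l) →
    (inversions l ≡ suc (inversions (swapAtᴸ a l))) ⊎ (inversions (swapAtᴸ a l) ≡ suc (inversions l))
  inversions-swapAtᴸ zero (x ∷ y ∷ r) _ nd with ℕP.<-cmp (toℕ x) (toℕ y)
  ... | tri< x<y _ _ = inj₂ (begin
    below y (x ∷ r) ℕ.+ (below x r ℕ.+ inversions r)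
      ≡⟨ cong (ℕ._+ _) (below-∷-< y x r x<y) ⟩
    suc (below y r ℕ.+ (below x r ℕ.+ inversions r))
      ≡⟨ cong suc (+-exchange (below y r) (below x r) (inversions r)) ⟩
    suc (below x r ℕ.+ (below y r ℕ.+ inversions r))
      ≡⟨ cong (λ c → suc (c ℕ.+ _)) (below-∷-≮ x y r (ℕP.<⇒≯ x<y)) ⟨
    suc (below x (y ∷ r) ℕ.+ (below y r ℕ.+ inversions r)) ∎)
  ... | tri≈ _ x≡y _ = ⊥-elim (All.head (AllPairs.head (noDup⇒Unique (x ∷ y ∷ r) nd)) (FP.toℕ-injective x≡y))
  ... | tri> _ _ y<x = inj₁ (begin
    below x (y ∷ r) ℕ.+ (below y r ℕ.+ inversions r)
      ≡⟨ cong (ℕ._+ _) (below-∷-< x y r y<x) ⟩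
    suc (below x r ℕ.+ (below y r ℕ.+ inversions r))
      ≡⟨ cong suc (+-exchange (below x r) (below y r) (inversions r)) ⟩
    suc (below y r ℕ.+ (below x r ℕ.+ inversions r))
      ≡⟨ cong (λ c → suc (c ℕ.+ _)) (below-∷-≮ y x r (ℕP.<⇒≯ y<x)) ⟨
    suc (below y (x ∷ r) ℕ.+ (below x r ℕ.+ inversions r)) ∎)
  inversions-swapAtᴸ zero (x ∷ []) (s≤s ()) _
  inversions-swapAtᴸ (suc a) (x ∷ r) (s≤s a<r) nd with inversions-swapAtᴸ a r a<r (proj₂ (Equivalence.to BP.T-∧ nd))
  ... | inj₁ e = inj₁ (begin
    below x r ℕ.+ inversions r
      ≡⟨ cong (below x r ℕ.+_) e ⟩
    below x r ℕ.+ suc (inversions (swapAtᴸ a r))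
      ≡⟨ ℕP.+-suc (below x r) _ ⟩
    suc (below x r ℕ.+ inversions (swapAtᴸ a r))
      ≡⟨ cong (λ c → suc (c ℕ.+ _)) (below-swapAtᴸ x a r) ⟨
    suc (below x (swapAtᴸ a r) ℕ.+ inversions (swapAtᴸ a r)) ∎)
  ... | inj₂ e = inj₂ (begin
    below x (swapAtᴸ a r) ℕ.+ inversions (swapAtᴸ a r)
      ≡⟨ cong₂ ℕ._+_ (below-swapAtᴸ x a r) e ⟩
    below x r ℕ.+ suc (inversions r)
      ≡⟨ ℕP.+-suc (below x r) _ ⟩
    suc (below x r ℕ.+ inversions r) ∎)

  sgn-suc : (σ τ : Perm n) → inversions (toList τ) ≡ suc (inversions (toList σ)) → sgn τ ≡ - sgn σ
  sgn-suc σ τ e rewrite e = refl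

  sgn-swapAt : (a : ℕ) (σ : Perm n) → suc a < n → T (noDup (toList σ)) → sgn (swapAt a σ) ≡ - sgn σ
  sgn-swapAt a σ a<n nd with inversions-swapAtᴸ a (toList σ) (subst (suc a <_) (sym (VP.length-toList σ)) a<n) nd
  ... | inj₁ e = trans (sym (⁻¹-involutive _))
    (cong -_ (sym (sgn-suc (swapAt a σ) σ (trans e (cong (suc ∘ inversions) (sym (toList-swapAt a σ)))))))
  ... | inj₂ e = sgn-suc σ (swapAt a σ) (trans (cong inversions (toList-swapAt a σ)) e)

  ∑-allTables-∷ : ∀ k (K : Vec (Fin n) (suc k) → ℚ) →
    ∑ K (allTables n (suc k)) ≡ ∑ (λ i → ∑ (K ∘ (i ∷ᵥ_)) (allTables n k)) (allFin n)
  ∑-allTables-∷ k K = trans (∑-concatMap K _ (allFin n)) (∑-cong (λ i → ∑-map K (i ∷ᵥ_) (allTables n k)) (allFin n))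

  ∑-allTables-swapAt : ∀ k (a : ℕ) (K : Vec (Fin n) k → ℚ) → ∑ (K ∘ swapAt a) (allTables n k) ≡ ∑ K (allTables n k)
  ∑-allTables-swapAt zero zero K = refl
  ∑-allTables-swapAt zero (suc a) K = refl
  ∑-allTables-swapAt (suc zero) zero K = ∑-cong (λ { (x ∷ᵥ []ᵥ) → refl }) (allTables n 1)
  ∑-allTables-swapAt (suc k) (suc a) K = begin
    ∑ (K ∘ swapAt (suc a)) (allTables n (suc k))
      ≡⟨ ∑-allTables-∷ k (K ∘ swapAt (suc a)) ⟩
    ∑ (λ i → ∑ (λ r → K (i ∷ᵥ swapAt a r)) (allTables n k)) (allFin n)
      ≡⟨ ∑-cong (λ i → ∑-allTables-swapAt k a (K ∘ (i ∷ᵥ_))) (allFin n) ⟩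
    ∑ (λ i → ∑ (K ∘ (i ∷ᵥ_)) (allTables n k)) (allFin n)
      ≡⟨ ∑-allTables-∷ k K ⟨
    ∑ K (allTables n (suc k)) ∎
  ∑-allTables-swapAt (suc (suc k)) zero K = begin
    ∑ (K ∘ swapAt 0) (allTables n (suc (suc k)))
      ≡⟨ ∑-allTables-∷ (suc k) (K ∘ swapAt 0) ⟩
    ∑ (λ i → ∑ (K ∘ swapAt 0 ∘ (i ∷ᵥ_)) (allTables n (suc k))) (allFin n)
      ≡⟨ ∑-cong (λ i → ∑-allTables-∷ k (K ∘ swapAt 0 ∘ (i ∷ᵥ_))) (allFin n) ⟩
    ∑ (λ i → ∑ (λ j → ∑ (λ r → K (j ∷ᵥ i ∷ᵥ r)) (allTables n k)) (allFin n)) (allFin n)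
      ≡⟨ ∑-comm (λ i j → ∑ (λ r → K (j ∷ᵥ i ∷ᵥ r)) (allTables n k)) (allFin n) (allFin n) ⟩
    ∑ (λ j → ∑ (λ i → ∑ (λ r → K (j ∷ᵥ i ∷ᵥ r)) (allTables n k)) (allFin n)) (allFin n)
      ≡⟨ ∑-cong (λ j → ∑-allTables-∷ k (K ∘ (j ∷ᵥ_))) (allFin n) ⟨
    ∑ (λ j → ∑ (K ∘ (j ∷ᵥ_)) (allTables n (suc k))) (allFin n)
      ≡⟨ ∑-allTables-∷ (suc k) K ⟨
    ∑ K (allTables n (suc (suc k))) ∎

  ∑-symGroup-swapAt : (a : ℕ) (J : Perm n → ℚ) → ∑ (J ∘ swapAt a) (symGroup n) ≡ ∑ J (symGroup n)
  ∑-symGroup-swapAt a J = begin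
    ∑ (J ∘ swapAt a) (symGroup n)
      ≡⟨ ∑-symGroup (J ∘ swapAt a) ⟩
    ∑ (λ σ → if noDup (toList σ) then J (swapAt a σ) else 0ℚ) (allTables n n)
      ≡⟨ ∑-cong (λ σ → cong (λ b → if b then J (swapAt a σ) else 0ℚ)
        (sym (noDup-swapAt σ))) (allTables n n) ⟩
    ∑ (K ∘ swapAt a) (allTables n n)
      ≡⟨ ∑-allTables-swapAt n a K ⟩
    ∑ K (allTables n n)
      ≡⟨ ∑-symGroup J ⟨
    ∑ J (symGroup n) ∎
    where
    K : Perm n → ℚ
    K σ = if noDup (toList σ) then J σ else 0ℚ
    noDup-swapAt : (σ : Perm n) → noDup (toList (swapAt a σ)) ≡ noDup (toList σ)
    noDup-swapAt σ = trans (cong noDup (toList-swapAt a σ)) (noDup-swapAtᴸ a (toList σ))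

-- The alternating pairing

transposeAt-other : ∀ a {k} (i : Fin k) → toℕ i ≢ a → toℕ i ≢ suc a → transposeAt a i ≡ i
transposeAt-other zero {suc (suc k)} fz i≢0 _ = ⊥-elim (i≢0 refl)
transposeAt-other zero {suc (suc k)} (fs fz) _ i≢1 = ⊥-elim (i≢1 refl)
transposeAt-other zero {suc (suc k)} (fs (fs i)) _ _ = refl
transposeAt-other zero {suc zero} fz i≢0 _ = ⊥-elim (i≢0 refl)
transposeAt-other (suc a) fz _ _ = refl
transposeAt-other (suc a) (fs i) i≢a i≢1+a = cong fs (transposeAt-other a i (i≢a ∘ cong suc) (i≢1+a ∘ cong suc))

transposeAt-cases : ∀ a {k} (i : Fin k) →
  toℕ (transposeAt a i) ≡ toℕ i ⊎ toℕ (transposeAt a i) ≡ a ⊎ toℕ (transposeAt a i) ≡ suc a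
transposeAt-cases zero {suc (suc k)} fz = inj₂ (inj₂ refl)
transposeAt-cases zero {suc (suc k)} (fs fz) = inj₂ (inj₁ refl)
transposeAt-cases zero {suc (suc k)} (fs (fs i)) = inj₁ refl
transposeAt-cases zero {suc zero} fz = inj₁ refl
transposeAt-cases (suc a) fz = inj₁ refl
transposeAt-cases (suc a) (fs i) with transposeAt-cases a i
... | inj₁ e = inj₁ (cong suc e)
... | inj₂ (inj₁ e) = inj₂ (inj₁ (cong suc e))
... | inj₂ (inj₂ e) = inj₂ (inj₂ (cong suc e))

transposeAt-≡ : ∀ a {k} (i : Fin k) → suc a < k → toℕ (transposeAt a i) ≡ a → toℕ i ≡ suc a
transposeAt-≡ zero {suc (suc k)} (fs fz) _ _ = refl
transposeAt-≡ zero {suc zero} fz (s≤s ()) _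
transposeAt-≡ (suc a) (fs i) (s≤s a<k) e = cong suc (transposeAt-≡ a i a<k (ℕP.suc-injective e))

module _ {n : ℕ} where
  open ≡-Reasoning

  onIndex : (Fin n → Fin n) → Gen n → Gen n
  onIndex φ (k , i) = (k , φ i)

  altPair : Word n → Word n → ℚ
  altPair v m = ∑ (λ σ → sgn σ * ⟨ map (actGen σ) v ∣ m ⟩) (symGroup n)

  altPair-transposeAt : (a : ℕ) → suc a < n → (v m : Word n) → altPair (map (onIndex (transposeAt a)) v) m ≡ - altPair v m
  altPair-transposeAt a a<n v m = begin
    ∑ (λ σ → sgn σ * ⟨ map (actGen σ) (map (onIndex (transposeAt a)) v) ∣ m ⟩) (symGroup n)
      ≡⟨ ∑-congᴬ (All.map (λ {σ} → term σ) symGroup-noDup) ⟩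
    ∑ (λ σ → - summand (swapAt a σ)) (symGroup n)
      ≡⟨ ∑-neg (summand ∘ swapAt a) (symGroup n) ⟩
    - ∑ (summand ∘ swapAt a) (symGroup n)
      ≡⟨ cong -_ (∑-symGroup-swapAt a summand) ⟩
    - altPair v m ∎
    where
    summand : Perm n → ℚ
    summand τ = sgn τ * ⟨ map (actGen τ) v ∣ m ⟩
    term : ∀ σ → T (noDup (toList σ)) →
      sgn σ * ⟨ map (actGen σ) (map (onIndex (transposeAt a)) v) ∣ m ⟩ ≡ - summand (swapAt a σ)
    term σ nd = begin
      sgn σ * ⟨ map (actGen σ) (map (onIndex (transposeAt a)) v) ∣ m ⟩
        ≡⟨ cong (λ w → sgn σ * ⟨ w ∣ m ⟩) (trans (sym (LP.map-∘ v))
          (LP.map-cong (λ g → cong (proj₁ g ,_) (sym (lookup-swapAt a σ (proj₂ g)))) v)) ⟩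
      sgn σ * ⟨ map (actGen (swapAt a σ)) v ∣ m ⟩
        ≡⟨ cong (_* ⟨ map (actGen (swapAt a σ)) v ∣ m ⟩)
          (trans (sym (⁻¹-involutive (sgn σ))) (cong -_ (sym (sgn-swapAt a σ a<n nd)))) ⟩
      - sgn (swapAt a σ) * ⟨ map (actGen (swapAt a σ)) v ∣ m ⟩
        ≡⟨ QP.neg-distribˡ-* (sgn (swapAt a σ)) ⟨ map (actGen (swapAt a σ)) v ∣ m ⟩ ⟨
      - summand (swapAt a σ) ∎

  Avoids : ℕ → Word n → Set
  Avoids x = All (λ g → toℕ (proj₂ g) ≢ x)

  Avoids? : (x : ℕ) (v : Word n) → Dec (Avoids x v)
  Avoids? x = All.all? (λ g → ¬? (toℕ (proj₂ g) ℕ.≟ x))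

  Avoids-transposeAt-≡ : (a : ℕ) → suc a < n → (v : Word n) → Avoids (suc a) v → Avoids a (map (onIndex (transposeAt a)) v)
  Avoids-transposeAt-≡ a a<n v av = AllP.map⁺ (All.map (λ {g} g≢1+a e → g≢1+a (transposeAt-≡ a (proj₂ g) a<n e)) av)

  Avoids-transposeAt-≢ : (a x : ℕ) (v : Word n) → x ≢ a → x ≢ suc a → Avoids x v → Avoids x (map (onIndex (transposeAt a)) v)
  Avoids-transposeAt-≢ a x v x≢a x≢1+a av = AllP.map⁺ (All.map (λ {g} → avoid (proj₂ g)) av)
    where
    avoid : (i : Fin n) → toℕ i ≢ x → toℕ (transposeAt a i) ≢ x
    avoid i i≢x e with transposeAt-cases a i
    ... | inj₁ e′ = i≢x (trans (sym e′) e)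
    ... | inj₂ (inj₁ e′) = x≢a (trans (sym e) e′)
    ... | inj₂ (inj₂ e′) = x≢1+a (trans (sym e) e′)

  map-transposeAt-Avoids : (a : ℕ) (v : Word n) → Avoids a v → Avoids (suc a) v → map (onIndex (transposeAt a)) v ≡ v
  map-transposeAt-Avoids a [] _ _ = refl
  map-transposeAt-Avoids a (g ∷ v) (g≢a ∷ av) (g≢1+a ∷ av′) =
    cong₂ _∷_ (cong (proj₁ g ,_) (transposeAt-other a (proj₂ g) g≢a g≢1+a)) (map-transposeAt-Avoids a v av av′)

  -- Transposing the indices y and y + 1 moves the gap at y + 1 down to y; once the gaps are
  -- adjacent, the transposition fixes v and negates altPair.
  altPair-Avoids : (x y : ℕ) → x < y → y < n → (v m : Word n) → Avoids x v → Avoids y v → altPair v m ≡ 0ℚ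
  altPair-Avoids x (suc y) (s≤s x≤y) 1+y<n v m avx avy with ℕP.m≤n⇒m<n∨m≡n x≤y
  ... | inj₂ refl = x≡-x⇒x≡0 (trans (cong (λ w → altPair w m) (sym (map-transposeAt-Avoids x v avx avy)))
                                     (altPair-transposeAt x 1+y<n v m))
  ... | inj₁ x<y = begin
    altPair v m
      ≡⟨ ⁻¹-involutive _ ⟨
    - - altPair v m
      ≡⟨ cong -_ (altPair-transposeAt y 1+y<n v m) ⟨
    - altPair v′ m
      ≡⟨ cong -_ (altPair-Avoids x y x<y (ℕP.<-trans (ℕP.n<1+n y) 1+y<n) v′ m
        (Avoids-transposeAt-≢ y x v (ℕP.<⇒≢ x<y) (ℕP.<⇒≢ (ℕP.m<n⇒m<1+n x<y)) avx)
        (Avoids-transposeAt-≡ y 1+y<n v avy)) ⟩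
    - 0ℚ
      ≡⟨⟩
    0ℚ ∎
    where
    v′ : Word n
    v′ = map (onIndex (transposeAt y)) v

-- Moving a permutation onto the polarization index

module _ {n : ℕ} where
  open ≡-Reasoning

  injective⇒surjective : (φ : Fin n → Fin n) → Injective _≡_ _≡_ φ → ∀ i → Σ (Fin n) λ j → φ j ≡ i
  injective⇒surjective φ φ-inj i with FP.any? (λ j → φ j F.≟ i)
  ... | yes hit = hit
  ... | no miss = ⊥-elim (pigeonhole-miss n φ φ-inj i (λ j φj≡i → miss (j , φj≡i)))
    where
    pigeonhole-miss : ∀ k (φ : Fin k → Fin k) → Injective _≡_ _≡_ φ → ∀ i → ¬ (∀ j → φ j ≢ i)
    pigeonhole-miss (suc k) φ φ-inj i miss with FP.pigeonhole (ℕP.n<1+n k) (λ j → F.punchOut (miss j ∘ sym))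
    ... | j , j′ , j<j′ , e = FP.<⇒≢ j<j′ (φ-inj (FP.punchOut-injective (miss j ∘ sym) (miss j′ ∘ sym) e))

  δ : Fin n → Fin n → ℚ
  δ a b = if does (a F.≟ b) then 1ℚ else 0ℚ

∑-allFin-suc : ∀ {n} (G : Fin (suc n) → ℚ) → ∑ G (allFin (suc n)) ≡ G fz + ∑ (G ∘ fs) (allFin n)
∑-allFin-suc {n} G = cong (G fz +_) (trans (cong (∑ G) (sym (LP.map-tabulate (λ i → i) fs))) (∑-map G fs (allFin n)))

∑-δ : ∀ {n} (a : Fin n) (G : Fin n → ℚ) → ∑ (λ i → δ a i * G i) (allFin n) ≡ G a
∑-δ {suc n} fz G = begin
  ∑ (λ i → δ fz i * G i) (allFin (suc n))
    ≡⟨ ∑-allFin-suc (λ i → δ fz i * G i) ⟩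
  1ℚ * G fz + ∑ (λ i → 0ℚ * G (fs i)) (allFin n)
    ≡⟨ cong₂ _+_ (QP.*-identityˡ (G fz)) (∑-zero (λ i → QP.*-zeroˡ (G (fs i))) (allFin n)) ⟩
  G fz + 0ℚ
    ≡⟨ QP.+-identityʳ (G fz) ⟩
  G fz ∎
  where open ≡-Reasoning
∑-δ {suc n} (fs a) G = begin
  ∑ (λ i → δ (fs a) i * G i) (allFin (suc n))
    ≡⟨ ∑-allFin-suc (λ i → δ (fs a) i * G i) ⟩
  0ℚ * G fz + ∑ (λ i → δ a i * G (fs i)) (allFin n)
    ≡⟨ cong₂ _+_ (QP.*-zeroˡ (G fz)) (∑-δ a (G ∘ fs)) ⟩
  0ℚ + G (fs a)
    ≡⟨ QP.+-identityˡ (G (fs a)) ⟩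
  G (fs a) ∎
  where open ≡-Reasoning

∑-reindex : ∀ {n} (φ : Fin n → Fin n) → Injective _≡_ _≡_ φ → (G : Fin n → ℚ) → ∑ G (allFin n) ≡ ∑ (G ∘ φ) (allFin n)
∑-reindex {n} φ φ-inj G = begin
  ∑ G (allFin n)
    ≡⟨ ∑-cong unfold (allFin n) ⟩
  ∑ (λ i → ∑ (λ j → δ (φ j) i * G i) (allFin n)) (allFin n)
    ≡⟨ ∑-comm (λ i j → δ (φ j) i * G i) (allFin n) (allFin n) ⟩
  ∑ (λ j → ∑ (λ i → δ (φ j) i * G i) (allFin n)) (allFin n)
    ≡⟨ ∑-cong (λ j → ∑-δ (φ j) G) (allFin n) ⟩
  ∑ (G ∘ φ) (allFin n) ∎
  where
  open ≡-Reasoning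
  unfold : ∀ i → G i ≡ ∑ (λ j → δ (φ j) i * G i) (allFin n)
  unfold i with injective⇒surjective φ φ-inj i
  ... | j₀ , refl = sym (begin
    ∑ (λ j → δ (φ j) (φ j₀) * G (φ j₀)) (allFin n)
      ≡⟨ ∑-cong (λ j → cong (_* G (φ j₀)) (δ-φ j)) (allFin n) ⟩
    ∑ (λ j → δ j₀ j * G (φ j₀)) (allFin n)
      ≡⟨ ∑-δ j₀ (λ _ → G (φ j₀)) ⟩
    G (φ j₀) ∎)
    where
    δ-φ : ∀ j → δ (φ j) (φ j₀) ≡ δ j₀ j
    δ-φ j with φ j F.≟ φ j₀ | j₀ F.≟ j
    ... | yes _ | yes _ = refl
    ... | no _ | no _ = refl
    ... | yes φj≡φj₀ | no j₀≢j = ⊥-elim (j₀≢j (sym (φ-inj φj≡φj₀)))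
    ... | no φj≢φj₀ | yes refl = ⊥-elim (φj≢φj₀ refl)

module _ {n : ℕ} where
  open ≡-Reasoning

  mapScaled : (Fin n → Fin n) → Scaled n → Scaled n
  mapScaled φ = Maybe.map (Product.map₂ (map (onIndex φ)))

  lin-mapScaled : (Φ : Word n → ℚ) (φ : Fin n → Fin n) (u : Scaled n) → lin Φ (mapScaled φ u) ≡ lin (Φ ∘ map (onIndex φ)) u
  lin-mapScaled Φ φ nothing = refl
  lin-mapScaled Φ φ (just _) = refl

  module _ {φ : Fin n → Fin n} (φ-inj : Injective _≡_ _≡_ φ) where

    onIndex-injective : Injective _≡_ _≡_ (onIndex φ)
    onIndex-injective {k , i} {k′ , i′} e = cong₂ _,_ (cong proj₁ e) (φ-inj (cong proj₂ e))

    derivWord-onIndex : (g : Gen n) (w : Word n) → derivWord (onIndex φ g) (map (onIndex φ) w) ≡ mapScaled φ (derivWord g w)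
    derivWord-onIndex g [] = refl
    derivWord-onIndex g (h ∷ t) with g ≟ᴳ h
    ... | yes refl = trans (derivWord-here (onIndex φ g) (map (onIndex φ) t)) (cong (mapScaled φ) (sym (derivWord-here g t)))
    ... | no g≢h = begin
      derivWord (onIndex φ g) (onIndex φ h ∷ map (onIndex φ) t)
        ≡⟨ derivWord-there _ (g≢h ∘ onIndex-injective) ⟩
      consNeg (derivWord (onIndex φ g) (map (onIndex φ) t)) (onIndex φ h)
        ≡⟨ cong (λ u → consNeg u (onIndex φ h)) (derivWord-onIndex g t) ⟩
      consNeg (mapScaled φ (derivWord g t)) (onIndex φ h)
        ≡⟨ consNeg-mapScaled (derivWord g t) ⟩
      mapScaled φ (consNeg (derivWord g t) h)
        ≡⟨ cong (mapScaled φ) (derivWord-there t g≢h) ⟨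
      mapScaled φ (derivWord g (h ∷ t)) ∎
      where
      consNeg-mapScaled : ∀ u → consNeg (mapScaled φ u) (onIndex φ h) ≡ mapScaled φ (consNeg u h)
      consNeg-mapScaled nothing = refl
      consNeg-mapScaled (just _) = refl

    derivIf-onIndex : (b : Bool) (g : Gen n) (u : Scaled n) →
      derivIf b (onIndex φ g) (mapScaled φ u) ≡ mapScaled φ (derivIf b g u)
    derivIf-onIndex false g u = refl
    derivIf-onIndex true g nothing = refl
    derivIf-onIndex true g (just (s , w)) =
      trans (cong (scaleBy s) (derivWord-onIndex g w)) (scaleBy-mapScaled (derivWord g w))
      where
      scaleBy-mapScaled : ∀ u → scaleBy s (mapScaled φ u) ≡ mapScaled φ (scaleBy s u)
      scaleBy-mapScaled nothing = refl
      scaleBy-mapScaled (just _) = refl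

    derivPolar-onIndex : (h k l : Bool) (j : Fin n) (w : Word n) →
      derivPolar h k l (φ j) (map (onIndex φ) w) ≡ mapScaled φ (derivPolar h k l j w)
    derivPolar-onIndex h k l j w = begin
      derivIf h (θ (φ j)) (derivIf k (ξ (φ j)) (derivIf l (ρ (φ j)) (mapScaled φ (just (1ℚ , w)))))
        ≡⟨ cong (derivIf h (θ (φ j)) ∘ derivIf k (ξ (φ j))) (derivIf-onIndex l (ρ j) _) ⟩
      derivIf h (θ (φ j)) (derivIf k (ξ (φ j)) (mapScaled φ (derivIf l (ρ j) (just (1ℚ , w)))))
        ≡⟨ cong (derivIf h (θ (φ j))) (derivIf-onIndex k (ξ j) _) ⟩
      derivIf h (θ (φ j)) (mapScaled φ (derivIf k (ξ j) (derivIf l (ρ j) (just (1ℚ , w)))))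
        ≡⟨ derivIf-onIndex h (θ j) _ ⟩
      mapScaled φ (derivPolar h k l j w) ∎

    Unique-map-onIndex : {w : Word n} → Unique w → Unique (map (onIndex φ) w)
    Unique-map-onIndex [] = []
    Unique-map-onIndex (g∉w ∷ uw) = AllP.map⁺ (All.map (_∘ onIndex-injective) g∉w) ∷ Unique-map-onIndex uw

    ∑-mulPolar-onIndex : (h k l : Bool) (w m : Word n) →
      ∑ (λ i → ⟨ map (onIndex φ) w ∣ mulPolar h k l i m ⟩) (allFin n) ≡
      ∑ (λ j → lin (λ v → ⟨ map (onIndex φ) v ∣ m ⟩) (derivPolar h k l j w)) (allFin n)
    ∑-mulPolar-onIndex h k l w m = begin
      ∑ (λ i → ⟨ map (onIndex φ) w ∣ mulPolar h k l i m ⟩) (allFin n)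
        ≡⟨ ∑-cong (λ i → ⟨⟩-mulPolar h k l i _ m) (allFin n) ⟩
      ∑ (λ i → lin ⟨_∣ m ⟩ (derivPolar h k l i (map (onIndex φ) w))) (allFin n)
        ≡⟨ ∑-reindex φ φ-inj _ ⟩
      ∑ (λ j → lin ⟨_∣ m ⟩ (derivPolar h k l (φ j) (map (onIndex φ) w))) (allFin n)
        ≡⟨ ∑-cong (λ j → cong (lin ⟨_∣ m ⟩) (derivPolar-onIndex h k l j w)) (allFin n) ⟩
      ∑ (λ j → lin ⟨_∣ m ⟩ (mapScaled φ (derivPolar h k l j w))) (allFin n)
        ≡⟨ ∑-cong (λ j → lin-mapScaled ⟨_∣ m ⟩ φ (derivPolar h k l j w)) (allFin n) ⟩
      ∑ (λ j → lin (λ v → ⟨ map (onIndex φ) v ∣ m ⟩) (derivPolar h k l j w)) (allFin n) ∎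

module _ {A B C : Set} where
  open ≡-Reasoning

  ∑-*-exchange : (a : A → ℚ) (c : C → ℚ) (L : A → B → C → ℚ) (xs : List A) (ys : List B) (zs : List C) →
    ∑ (λ x → a x * ∑ (λ y → ∑ (λ z → c z * L x y z) zs) ys) xs ≡ ∑ (λ y → ∑ (λ z → c z * ∑ (λ x → a x * L x y z) xs) zs) ys
  ∑-*-exchange a c L xs ys zs = begin
    ∑ (λ x → a x * ∑ (λ y → ∑ (λ z → c z * L x y z) zs) ys) xs
      ≡⟨ ∑-cong (λ x → pull-in x) xs ⟩
    ∑ (λ x → ∑ (λ y → ∑ (λ z → a x * (c z * L x y z)) zs) ys) xs
      ≡⟨ ∑-comm _ xs ys ⟩
    ∑ (λ y → ∑ (λ x → ∑ (λ z → a x * (c z * L x y z)) zs) xs) ys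
      ≡⟨ ∑-cong (λ y → ∑-comm _ xs zs) ys ⟩
    ∑ (λ y → ∑ (λ z → ∑ (λ x → a x * (c z * L x y z)) xs) zs) ys
      ≡⟨ ∑-cong (λ y → ∑-cong (λ z → pull-out y z) zs) ys ⟩
    ∑ (λ y → ∑ (λ z → c z * ∑ (λ x → a x * L x y z) xs) zs) ys ∎
    where
    pull-in : ∀ x → a x * ∑ (λ y → ∑ (λ z → c z * L x y z) zs) ys ≡ ∑ (λ y → ∑ (λ z → a x * (c z * L x y z)) zs) ys
    pull-in x = sym (trans (∑-cong (λ y → ∑-*ˡ (a x) _ zs) ys) (∑-*ˡ (a x) _ ys))
    pull-out : ∀ y z → ∑ (λ x → a x * (c z * L x y z)) xs ≡ c z * ∑ (λ x → a x * L x y z) xs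
    pull-out y z = trans (∑-cong (λ x → solve 3 (λ p q r → p :* (q :* r) := q :* (p :* r)) refl (a x) (c z) (L x y z)) xs)
                         (∑-*ˡ (c z) _ xs)

module _ {n : ℕ} {A : Set} where

  lin-∑ : (a : A → ℚ) (Φ : A → Word n → ℚ) (xs : List A) (u : Scaled n) →
    ∑ (λ x → a x * lin (Φ x) u) xs ≡ lin (λ v → ∑ (λ x → a x * Φ x v) xs) u
  lin-∑ a Φ xs nothing = ∑-zero (λ x → QP.*-zeroʳ (a x)) xs
  lin-∑ a Φ xs (just (s , w)) =
    trans (∑-cong (λ x → solve 3 (λ p q r → p :* (q :* r) := q :* (p :* r)) refl (a x) s (Φ x w)) xs)
          (∑-*ˡ s (λ x → a x * Φ x w) xs)

module _ {n : ℕ} where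
  open ≡-Reasoning

  antisym-WordsUnique : (F : Elt n) → WordsUnique F → WordsUnique (antisym F)
  antisym-WordsUnique F uF = concatMap-All (λ σ → map (λ t → (sgn σ * proj₁ t , proj₂ t)) (act σ F))
    (λ {σ} nd → AllP.map⁺ (AllP.map⁺ (All.map (Unique-map-onIndex (noDup⇒lookup-injective σ nd)) uF))) symGroup-noDup

  ⟪⟫-antisym : (F : Elt n) (m : Word n) → ⟪ antisym F ∣ m ⟫ ≡ ∑ (λ σ → sgn σ * ⟪ act σ F ∣ m ⟫) (symGroup n)
  ⟪⟫-antisym F m = trans (∑-concatMap _ _ (symGroup n)) (∑-cong signed (symGroup n))
    where
    signed : ∀ σ → ⟪ map (λ t → (sgn σ * proj₁ t , proj₂ t)) (act σ F) ∣ m ⟫ ≡ sgn σ * ⟪ act σ F ∣ m ⟫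
    signed σ = trans (∑-map _ _ (act σ F))
      (trans (∑-cong (λ t → QP.*-assoc (sgn σ) (proj₁ t) ⟨ proj₂ t ∣ m ⟩) (act σ F)) (∑-*ˡ (sgn σ) _ (act σ F)))

  ∑-⟪⟫-act-mulPolar : (σ : Perm n) → Injective _≡_ _≡_ (lookup σ) → (h k l : Bool) (F : Elt n) (m : Word n) →
    ∑ (λ i → ⟪ act σ F ∣ mulPolar h k l i m ⟫) (allFin n) ≡
    ∑ (λ j → ∑ (λ t → proj₁ t * lin (λ v → ⟨ map (actGen σ) v ∣ m ⟩) (derivPolar h k l j (proj₂ t))) F) (allFin n)
  ∑-⟪⟫-act-mulPolar σ σ-inj h k l F m = begin
    ∑ (λ i → ⟪ act σ F ∣ mulPolar h k l i m ⟫) (allFin n)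
      ≡⟨ ∑-cong (λ i → ∑-map _ _ F) (allFin n) ⟩
    ∑ (λ i → ∑ (λ t → proj₁ t * P i (proj₂ t)) F) (allFin n)
      ≡⟨ ∑-comm _ (allFin n) F ⟩
    ∑ (λ t → ∑ (λ i → proj₁ t * P i (proj₂ t)) (allFin n)) F
      ≡⟨ ∑-cong (λ t → ∑-*ˡ (proj₁ t) _ (allFin n)) F ⟩
    ∑ (λ t → proj₁ t * ∑ (λ i → P i (proj₂ t)) (allFin n)) F
      ≡⟨ ∑-cong (λ t → cong (proj₁ t *_)
        (∑-mulPolar-onIndex σ-inj h k l (proj₂ t) m)) F ⟩
    ∑ (λ t → proj₁ t * ∑ (λ j → L j (proj₂ t)) (allFin n)) F
      ≡⟨ ∑-cong (λ t → sym (∑-*ˡ (proj₁ t) _ (allFin n))) F ⟩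
    ∑ (λ t → ∑ (λ j → proj₁ t * L j (proj₂ t)) (allFin n)) F
      ≡⟨ ∑-comm _ F (allFin n) ⟩
    ∑ (λ j → ∑ (λ t → proj₁ t * L j (proj₂ t)) F) (allFin n) ∎
    where
    P : Fin n → Word n → ℚ
    P i w = ⟨ map (actGen σ) w ∣ mulPolar h k l i m ⟩
    L : Fin n → Word n → ℚ
    L j w = lin (λ v → ⟨ map (actGen σ) v ∣ m ⟩) (derivPolar h k l j w)

  -- Moving each permutation σ from the word onto the summation index of the polarization
  -- leaves the alternating pairing against the polarized words of F.
  polarized-antisym-IsZero : (F : Elt n) → WordsUnique F → (h k l : Bool) →
    (∀ m j → ∑ (λ t → proj₁ t * lin (λ v → altPair v m) (derivPolar h k l j (proj₂ t))) F ≡ 0ℚ) →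
    IsZero (polarized h k l (antisym F))
  polarized-antisym-IsZero F uF h k l vanishes = ⟪⟫-zero⇒IsZero (polarized h k l (antisym F)) λ m → begin
    ⟪ polarized h k l (antisym F) ∣ m ⟫
      ≡⟨ ⟪⟫-polarized h k l (antisym F) m (antisym-WordsUnique F uF) ⟩
    ∑ (λ i → ⟪ antisym F ∣ mulPolar h k l i m ⟫) (allFin n)
      ≡⟨ ∑-cong (λ i → ⟪⟫-antisym F (mulPolar h k l i m)) (allFin n) ⟩
    ∑ (λ i → ∑ (λ σ → sgn σ * ⟪ act σ F ∣ mulPolar h k l i m ⟫) (symGroup n)) (allFin n)
      ≡⟨ ∑-comm _ (allFin n) (symGroup n) ⟩
    ∑ (λ σ → ∑ (λ i → sgn σ * ⟪ act σ F ∣ mulPolar h k l i m ⟫) (allFin n)) (symGroup n)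
      ≡⟨ ∑-congᴬ (All.map (λ {σ} nd → trans (∑-*ˡ (sgn σ) _ (allFin n))
        (cong (sgn σ *_) (∑-⟪⟫-act-mulPolar σ (noDup⇒lookup-injective σ nd) h k l F m))) symGroup-noDup) ⟩
    ∑ (λ σ → sgn σ * ∑ (λ j → ∑ (λ t → proj₁ t * L m σ j t) F) (allFin n)) (symGroup n)
      ≡⟨ ∑-*-exchange sgn proj₁ (L m) (symGroup n) (allFin n) F ⟩
    ∑ (λ j → ∑ (λ t → proj₁ t * ∑ (λ σ → sgn σ * L m σ j t) (symGroup n)) F) (allFin n)
      ≡⟨ ∑-cong (λ j → ∑-cong (λ t → cong (proj₁ t *_)
        (lin-∑ sgn (λ σ v → ⟨ map (actGen σ) v ∣ m ⟩) (symGroup n) (derivPolar h k l j (proj₂ t)))) F) (allFin n) ⟩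
    ∑ (λ j → ∑ (λ t → proj₁ t * lin (λ v → altPair v m) (derivPolar h k l j (proj₂ t))) F) (allFin n)
      ≡⟨ ∑-zero (vanishes m) (allFin n) ⟩
    0ℚ ∎
    where
    L : Word n → Perm n → Fin n → ℚ × Word n → ℚ
    L m σ j t = lin (λ v → ⟨ map (actGen σ) v ∣ m ⟩) (derivPolar h k l j (proj₂ t))

  -- The seeds

  derivWord-All-except : {R : Gen n → Set} (g : Gen n) (w : Word n) → Unique w → All (λ y → y ≡ g ⊎ R y) w →
    Holds (All R) (derivWord g w)
  derivWord-All-except {R} g = derivWord-ind g (λ w u → Unique w → All (λ y → y ≡ g ⊎ R y) w → Holds (All R) u)
    (λ _ _ → nothing)
    (λ t u ps → just (All.zipWith (λ { (g≢y , inj₁ y≡g) → ⊥-elim (g≢y (sym y≡g)) ; (_ , inj₂ r) → r })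
                                  (AllPairs.head u , All.tail ps)))
    (λ t g≢y ih u ps → Holds-consNeg _ (MAll.map ([ (λ y≡g → ⊥-elim (g≢y (sym y≡g))) , (λ r → r) ] (All.head ps) ∷_)
                                           (ih (AllPairs.tail u) (All.tail ps))))

  Avoids⇒∌ : {i : Fin n} (k : Fin 3) {w : Word n} → Avoids (toℕ i) w → All ((k , i) ≢_) w
  Avoids⇒∌ k = All.map (λ y≢i ki≡y → y≢i (cong (toℕ ∘ proj₂) (sym ki≡y)))

  derivIf-nothing : (b : Bool) (g : Gen n) → derivIf b g nothing ≡ nothing
  derivIf-nothing true g = refl
  derivIf-nothing false g = refl

  θOnlyAt : Fin n → Gen n → Set
  θOnlyAt j y = y ≡ θ j ⊎ toℕ (proj₂ y) ≢ toℕ j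

  θOnlyAt-θ : (j i : Fin n) → θOnlyAt j (θ i)
  θOnlyAt-θ j i with i F.≟ j
  ... | yes refl = inj₁ refl
  ... | no i≢j = inj₂ (i≢j ∘ FP.toℕ-injective)

  θOnlyAt⇒∉ : {j : Fin n} (k : Fin 3) → k ≢ fz → {w : Word n} → All (θOnlyAt j) w → All ((k , j) ≢_) w
  θOnlyAt⇒∉ k k≢0 = All.map λ { (inj₁ refl) e → k≢0 (cong proj₁ e) ; (inj₂ y≢j) e → y≢j (cong (toℕ ∘ proj₂) (sym e)) }

  -- A ξ_j- or ρ_j-derivative kills w, and ∂_{θ_j} w avoids both j and top (or is zero if j = top).
  altPair-derivPolar-θOnlyAt : (m : Word n) (j : Fin n) (top : ℕ) (w : Word n) → Unique w → All (θOnlyAt j) w →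
    Avoids top w → top < n → toℕ j ≤ top → ∀ h k l → T (h ∨ k ∨ l) → lin (λ v → altPair v m) (derivPolar h k l j w) ≡ 0ℚ
  altPair-derivPolar-θOnlyAt m j top w uw θw avw top<n j≤top h k true _ = cong (lin (λ v → altPair v m)) (begin
    derivIf h (θ j) (derivIf k (ξ j) (scaleBy 1ℚ (derivWord (ρ j) w)))
      ≡⟨ cong (derivIf h (θ j) ∘ derivIf k (ξ j) ∘ scaleBy 1ℚ)
        (derivWord-∉ (ρ j) w (θOnlyAt⇒∉ (fs (fs fz)) (λ ()) θw)) ⟩
    derivIf h (θ j) (derivIf k (ξ j) nothing)
      ≡⟨ cong (derivIf h (θ j)) (derivIf-nothing k (ξ j)) ⟩
    derivIf h (θ j) nothing
      ≡⟨ derivIf-nothing h (θ j) ⟩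
    nothing ∎)
  altPair-derivPolar-θOnlyAt m j top w uw θw avw top<n j≤top h true false _ = cong (lin (λ v → altPair v m)) (begin
    derivIf h (θ j) (scaleBy 1ℚ (derivWord (ξ j) w))
      ≡⟨ cong (derivIf h (θ j) ∘ scaleBy 1ℚ)
        (derivWord-∉ (ξ j) w (θOnlyAt⇒∉ (fs fz) (λ ()) θw)) ⟩
    derivIf h (θ j) nothing
      ≡⟨ derivIf-nothing h (θ j) ⟩
    nothing ∎)
  altPair-derivPolar-θOnlyAt m j top w uw θw avw top<n j≤top true false false _ with ℕP.m≤n⇒m<n∨m≡n j≤top
  ... | inj₁ j<top = trans (lin-scaleBy _ 1ℚ (derivWord (θ j) w)) (trans (cong (1ℚ *_)
        (lin-zeroᴴ (λ {v} av → altPair-Avoids (toℕ j) top j<top top<n v m (All.map proj₁ av) (All.map proj₂ av))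
                   (derivWord-All-except (θ j) w uw (All.zipWith avoids-both (θw , avw))))) (QP.*-zeroʳ 1ℚ))
    where
    avoids-both : ∀ {y} → θOnlyAt j y × toℕ (proj₂ y) ≢ top → y ≡ θ j ⊎ (toℕ (proj₂ y) ≢ toℕ j × toℕ (proj₂ y) ≢ top)
    avoids-both (inj₁ y≡θj , _) = inj₁ y≡θj
    avoids-both (inj₂ y≢j , y≢top) = inj₂ (y≢j , y≢top)
  ... | inj₂ refl = cong (lin (λ v → altPair v m) ∘ scaleBy 1ℚ) (derivWord-∉ (θ j) w (Avoids⇒∌ fz avw))

  appendScaled : Word n → Scaled n → Scaled n
  appendScaled t = Maybe.map (Product.map₂ (_++ t))

  lin-appendScaled : (Φ : Word n → ℚ) (t : Word n) (u : Scaled n) → lin Φ (appendScaled t u) ≡ lin (Φ ∘ (_++ t)) u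
  lin-appendScaled Φ t nothing = refl
  lin-appendScaled Φ t (just _) = refl

  derivWord-++ : (g : Gen n) (p t : Word n) → All (g ≢_) t → derivWord g (p ++ t) ≡ appendScaled t (derivWord g p)
  derivWord-++ g p t g∉t = derivWord-ind g (λ p u → derivWord g (p ++ t) ≡ appendScaled t u)
    (derivWord-∉ g t g∉t) (λ p → derivWord-here g (p ++ t))
    (λ {y} p g≢y ih → trans (derivWord-there (p ++ t) g≢y)
      (trans (cong (λ u → consNeg u y) ih) (consNeg-appendScaled (derivWord g p)))) p
    where
    consNeg-appendScaled : ∀ {y} u → consNeg (appendScaled t u) y ≡ appendScaled t (consNeg u y)
    consNeg-appendScaled nothing = refl
    consNeg-appendScaled (just _) = refl

  derivIf-++ : (b : Bool) (g : Gen n) (t : Word n) → All (g ≢_) t → (u : Scaled n) →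
    derivIf b g (appendScaled t u) ≡ appendScaled t (derivIf b g u)
  derivIf-++ false g t g∉t u = refl
  derivIf-++ true g t g∉t nothing = refl
  derivIf-++ true g t g∉t (just (s , p)) =
    trans (cong (scaleBy s) (derivWord-++ g p t g∉t)) (scaleBy-appendScaled (derivWord g p))
    where
    scaleBy-appendScaled : ∀ u → scaleBy s (appendScaled t u) ≡ appendScaled t (scaleBy s u)
    scaleBy-appendScaled nothing = refl
    scaleBy-appendScaled (just _) = refl

  derivPolar-++ : (h k l : Bool) (j : Fin n) (p t : Word n) → Avoids (toℕ j) t →
    derivPolar h k l j (p ++ t) ≡ appendScaled t (derivPolar h k l j p)
  derivPolar-++ h k l j p t avt = begin
    derivIf h (θ j) (derivIf k (ξ j) (derivIf l (ρ j) (appendScaled t (just (1ℚ , p)))))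
      ≡⟨ cong (derivIf h (θ j) ∘ derivIf k (ξ j)) (derivIf-++ l (ρ j) t (Avoids⇒∌ _ avt) _) ⟩
    derivIf h (θ j) (derivIf k (ξ j) (appendScaled t (derivIf l (ρ j) (just (1ℚ , p)))))
      ≡⟨ cong (derivIf h (θ j)) (derivIf-++ k (ξ j) t (Avoids⇒∌ _ avt) _) ⟩
    derivIf h (θ j) (appendScaled t (derivIf k (ξ j) (derivIf l (ρ j) (just (1ℚ , p)))))
      ≡⟨ derivIf-++ h (θ j) t (Avoids⇒∌ _ avt) _ ⟩
    appendScaled t (derivPolar h k l j p) ∎

Δ₁-harmonic : (m : ℕ) → InT (suc m) (Δ₁ m)
Δ₁-harmonic m h k l hkl = polarized-antisym-IsZero F (Unique-W ∷ []) h k l vanishes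
  where
  W : Word (suc m)
  W = map (λ i → θ (inject₁ i)) (allFin m)
  F : Elt (suc m)
  F = (1ℚ , W) ∷ []
  Unique-W : Unique W
  Unique-W = UP.map⁺ (λ e → FP.inject₁-injective (cong proj₂ e)) (UP.allFin⁺ m)
  vanishes : ∀ M j → ∑ (λ t → proj₁ t * lin (λ v → altPair v M) (derivPolar h k l j (proj₂ t))) F ≡ 0ℚ
  vanishes M j = trans (cong (λ z → 1ℚ * z + 0ℚ) (altPair-derivPolar-θOnlyAt M j m W Unique-W
      (All-map-allFin _ (λ i → θOnlyAt-θ j (inject₁ i)))
      (All-map-allFin _ (λ i e → ℕP.<⇒≢ (subst (_< m) (sym (FP.toℕ-inject₁ i)) (FP.toℕ<n i)) e))
      (ℕP.n<1+n m) (ℕP.≤-pred (FP.toℕ<n j)) h k l hkl)) refl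

module Δ₂-harmonic (m : ℕ) where
  open ≡-Reasoning

  N top : ℕ
  N = 3 ℕ.+ m
  top = 2 ℕ.+ m

  i0 i1 : Fin N
  i0 = fz
  i1 = fs fz

  tail : Word N
  tail = map (λ j → θ (fs (fs (inject₁ j)))) (allFin m)

  pA pB pC : Word N
  pA = θ i0 ∷ ξ i1 ∷ ρ i1 ∷ []
  pB = θ i1 ∷ ξ i0 ∷ ρ i1 ∷ []
  pC = θ i1 ∷ ξ i1 ∷ ρ i0 ∷ []

  F₂ : Elt N
  F₂ = (1ℚ , pA ++ tail) ∷ (1ℚ , pB ++ tail) ∷ (1ℚ , pC ++ tail) ∷ []

  tail-Avoids-0 : Avoids 0 tail
  tail-Avoids-0 = All-map-allFin _ (λ j ())

  tail-Avoids-1 : Avoids 1 tail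
  tail-Avoids-1 = All-map-allFin _ (λ j ())

  tail-Avoids-top : Avoids top tail
  tail-Avoids-top = All-map-allFin _ (λ j e → ℕP.<⇒≢ (subst (_< m) (sym (FP.toℕ-inject₁ j)) (FP.toℕ<n j))
                                                    (ℕP.suc-injective (ℕP.suc-injective e)))

  Unique-tail : Unique tail
  Unique-tail = UP.map⁺ (λ e → FP.inject₁-injective (FP.suc-injective (FP.suc-injective (cong proj₂ e)))) (UP.allFin⁺ m)

  ∌0 : ∀ {k} → All ((k , i0) ≢_) tail
  ∌0 = Avoids⇒∌ _ tail-Avoids-0

  ∌1 : ∀ {k} → All ((k , i1) ≢_) tail
  ∌1 = Avoids⇒∌ _ tail-Avoids-1

  Unique-A : Unique (pA ++ tail)
  Unique-A = ((λ ()) ∷ (λ ()) ∷ ∌0) ∷ ((λ ()) ∷ ∌1) ∷ ∌1 ∷ Unique-tail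

  Unique-B : Unique (pB ++ tail)
  Unique-B = ((λ ()) ∷ (λ ()) ∷ ∌1) ∷ ((λ ()) ∷ ∌0) ∷ ∌1 ∷ Unique-tail

  Unique-C : Unique (pC ++ tail)
  Unique-C = ((λ ()) ∷ (λ ()) ∷ ∌1) ∷ ((λ ()) ∷ ∌1) ∷ ∌0 ∷ Unique-tail

  module _ (M : Word N) where

    Φ : Word N → ℚ
    Φ v = altPair (v ++ tail) M

    term : Bool → Bool → Bool → Fin N → Word N → ℚ
    term h k l j p = lin Φ (derivPolar h k l j p)

    gap : (x : ℕ) → x < top → Avoids x tail → {s : ℚ} {v : Word N} →
      True (Avoids? x v) → True (Avoids? top v) → lin Φ (just (s , v)) ≡ 0ℚ
    gap x x<top avx {s} {v} v-avoids-x v-avoids-top = trans (cong (s *_)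
      (altPair-Avoids x top x<top (ℕP.n<1+n top) (v ++ tail) M
        (AllP.++⁺ (toWitness v-avoids-x) avx) (AllP.++⁺ (toWitness v-avoids-top) tail-Avoids-top))) (QP.*-zeroʳ s)

    gap₀ : {s : ℚ} {v : Word N} → True (Avoids? 0 v) → True (Avoids? top v) → lin Φ (just (s , v)) ≡ 0ℚ
    gap₀ {s} = gap 0 (s≤s z≤n) tail-Avoids-0 {s}

    gap₁ : {s : ℚ} {v : Word N} → True (Avoids? 1 v) → True (Avoids? top v) → lin Φ (just (s , v)) ≡ 0ℚ
    gap₁ {s} = gap 1 (s≤s (s≤s z≤n)) tail-Avoids-1 {s}

    cancel : {s : ℚ} (v : Word N) → lin Φ (just (s , v)) + lin Φ (just (s , map (onIndex (transposeAt 0)) v)) ≡ 0ℚ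
    cancel {s} v = begin
      s * Φ v + s * Φ (map (onIndex (transposeAt 0)) v)
        ≡⟨ cong (λ z → s * Φ v + s * z) Φ-transpose ⟩
      s * Φ v + s * - Φ v
        ≡⟨ solve 2 (λ s a → s :* a :+ s :* (:- a) := con 0ℚ) refl s (Φ v) ⟩
      0ℚ ∎
      where
      Φ-transpose : Φ (map (onIndex (transposeAt 0)) v) ≡ - Φ v
      Φ-transpose = begin
        altPair (map (onIndex (transposeAt 0)) v ++ tail) M
          ≡⟨ cong (λ t → altPair (map (onIndex (transposeAt 0)) v ++ t) M)
            (map-transposeAt-Avoids 0 tail tail-Avoids-0 tail-Avoids-1) ⟨
        altPair (map (onIndex (transposeAt 0)) v ++ map (onIndex (transposeAt 0)) tail) M
          ≡⟨ cong (λ w → altPair w M) (LP.map-++ _ v tail) ⟨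
        altPair (map (onIndex (transposeAt 0)) (v ++ tail)) M
          ≡⟨ altPair-transposeAt 0 (s≤s (s≤s z≤n)) (v ++ tail) M ⟩
        - altPair (v ++ tail) M ∎

    -- Each word carries a single letter of index 0, so at most one of them survives a
    -- derivative there, and what survives avoids the index 0.
    terms-at-0 : ∀ h k l → T (h ∨ k ∨ l) → term h k l i0 pA ≡ 0ℚ × term h k l i0 pB ≡ 0ℚ × term h k l i0 pC ≡ 0ℚ
    terms-at-0 true true true _ = refl , refl , refl
    terms-at-0 true true false _ = refl , refl , refl
    terms-at-0 true false true _ = refl , refl , refl
    terms-at-0 false true true _ = refl , refl , refl
    terms-at-0 true false false _ = gap₀ {1ℚ} {ξ i1 ∷ ρ i1 ∷ []} _ _ , refl , refl
    terms-at-0 false true false _ = refl , gap₀ { - 1ℚ} {θ i1 ∷ ρ i1 ∷ []} _ _ , refl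
    terms-at-0 false false true _ = refl , refl , gap₀ {1ℚ} {θ i1 ∷ ξ i1 ∷ []} _ _

    -- Index 1 carries two letters in each word: a double derivative leaves a word avoiding
    -- the index 1, and the single derivatives survive on two words that differ by the
    -- transposition of the indices 0 and 1.
    terms-at-1 : ∀ h k l → T (h ∨ k ∨ l) → term h k l i1 pA + (term h k l i1 pB + term h k l i1 pC) ≡ 0ℚ
    terms-at-1 true true true _ = refl
    terms-at-1 true true false _ = cong (λ c → 0ℚ + (0ℚ + c)) (gap₁ { - 1ℚ} {ρ i0 ∷ []} _ _)
    terms-at-1 true false true _ = cong (λ b → 0ℚ + (b + 0ℚ)) (gap₁ {1ℚ} {ξ i0 ∷ []} _ _)
    terms-at-1 false true true _ = cong (λ a → a + (0ℚ + 0ℚ)) (gap₁ { - 1ℚ} {θ i0 ∷ []} _ _)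
    terms-at-1 true false false _ = cong (0ℚ +_) (cancel {1ℚ} (ξ i0 ∷ ρ i1 ∷ []))
    terms-at-1 false true false _ =
      trans (cong (term false true false i1 pA +_) (QP.+-identityˡ (term false true false i1 pC)))
            (cancel { - 1ℚ} (θ i0 ∷ ρ i1 ∷ []))
    terms-at-1 false false true _ =
      trans (sym (QP.+-assoc (term false false true i1 pA) (term false false true i1 pB) 0ℚ))
            (trans (QP.+-identityʳ _) (cancel {1ℚ} (θ i0 ∷ ξ i1 ∷ [])))

    ∑-F₂ : ∀ h k l j → Avoids (toℕ j) tail →
      ∑ (λ t → proj₁ t * lin (λ v → altPair v M) (derivPolar h k l j (proj₂ t))) F₂ ≡
      term h k l j pA + (term h k l j pB + term h k l j pC)
    ∑-F₂ h k l j avj = trans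
      (cong₂ _+_ (cong (1ℚ *_) (split pA)) (cong₂ _+_ (cong (1ℚ *_) (split pB)) (cong (λ z → 1ℚ * z + 0ℚ) (split pC))))
      (solve 3 (λ a b c → con 1ℚ :* a :+ (con 1ℚ :* b :+ (con 1ℚ :* c :+ con 0ℚ)) := a :+ (b :+ c)) refl
        (term h k l j pA) (term h k l j pB) (term h k l j pC))
      where
      split : (p : Word N) → lin (λ v → altPair v M) (derivPolar h k l j (p ++ tail)) ≡ term h k l j p
      split p = trans (cong (lin (λ v → altPair v M)) (derivPolar-++ h k l j p tail avj))
                      (lin-appendScaled (λ v → altPair v M) tail (derivPolar h k l j p))

  harmonic : InT N (Δ₂ m)
  harmonic h k l hkl = polarized-antisym-IsZero F₂ (Unique-A ∷ Unique-B ∷ Unique-C ∷ []) h k l vanishes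
    where
    vanishes : ∀ M j → ∑ (λ t → proj₁ t * lin (λ v → altPair v M) (derivPolar h k l j (proj₂ t))) F₂ ≡ 0ℚ
    vanishes M fz with terms-at-0 M h k l hkl
    ... | a , b , c = trans (∑-F₂ M h k l i0 tail-Avoids-0) (cong₂ _+_ a (cong₂ _+_ b c))
    vanishes M (fs fz) = trans (∑-F₂ M h k l i1 tail-Avoids-1) (terms-at-1 M h k l hkl)
    vanishes M (fs (fs j)) = cong₂ _+_ (cong (1ℚ *_) (θ-only pA Unique-A))
      (cong₂ _+_ (cong (1ℚ *_) (θ-only pB Unique-B)) (cong (λ z → 1ℚ * z + 0ℚ) (θ-only pC Unique-C)))
      where
      low⇒≢ : ∀ {x} {g : Gen N} → toℕ (proj₂ g) < 2 → toℕ (proj₂ g) ≢ 2 ℕ.+ x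
      low⇒≢ g<2 e = ℕP.<⇒≱ g<2 (subst (2 ℕ.≤_) (sym e) (s≤s (s≤s z≤n)))
      θ-only : (p : Word N) → Unique (p ++ tail) → {low : True (All.all? (λ g → toℕ (proj₂ g) ℕ.<? 2) p)} →
        lin (λ v → altPair v M) (derivPolar h k l (fs (fs j)) (p ++ tail)) ≡ 0ℚ
      θ-only p u {low} = altPair-derivPolar-θOnlyAt M (fs (fs j)) top (p ++ tail) u
        (AllP.++⁺ (All.map (λ {g} g<2 → inj₂ (low⇒≢ {toℕ j} {g} g<2)) (toWitness low)) (All-map-allFin _ (λ i → θOnlyAt-θ (fs (fs j)) _)))
        (AllP.++⁺ (All.map (λ {g} → low⇒≢ {m} {g}) (toWitness low)) tail-Avoids-top)
        (ℕP.n<1+n top) (s≤s (s≤s (ℕP.≤-pred (FP.toℕ<n j)))) h k l hkl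

proposition4p4 : ((m : ℕ) → InT (suc m) (Δ₁ m)) × ((m : ℕ) → InT (3 ℕ.+ m) (Δ₂ m))
proposition4p4 = Δ₁-harmonic , Δ₂-harmonic.harmonic
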